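{- For the path $P_n$ on $n\ge 1$ vertices, $$PRC(P_n)=\begin{cases}1 & \text{if } n=1,\\ 2 & \text{if } n=2,\\ 0 & \text{if } n=3,\\ 4 & \text{if } n\in\{4,6,8\},\\ 3 & \text{if } n=5,\\ 5 & \text{if } n\in\{7,9,10,11,13\},\\ 6 & \text{otherwise.}\end{cases}$$
   Context: All graphs are simple, finite and undirected. A set $S\subseteq V(G)$ is a dominating set if every vertex not in $S$ has a neighbor in $S$; $S$ is a perfect dominating set if every vertex in $V(G)\setminus S$ has exactly one neighbor in $S$. A perfect coalition in $G$ consists of two disjoint sets $V_1,V_2$ of vertices such that (i) neither $V_1$ nor $V_2$ is a dominating set of $G$; (ii) each vertex in $V(G)\setminus V_1$ has at most one neighbor in $V_1$, and each vertex in $V(G)\setminus V_2$ has at most one neighbor in $V_2$; (iii) $V_1\cup V_2$ is a perfect dominating set of $G$. A perfect coalition partition ($prc$-partition) of $G$ is a vertex partition $\pi=\{V_1,\dots,V_k\}$ such that each $V_i$ either is a singleton dominating set or forms a perfect coalition with some $V_j\in\pi$. $PRC(G)$ is the maximum cardinality of a $prc$-partition of $G$, with $PRC(G)=0$ if $G$ has no $prc$-partition. $P_n$ denotes the path on $n$ vertices. -}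

module Defs where

open import Data.Nat using (ℕ; zero; suc; _+_; _≤_)
open import Data.Fin using (Fin; toℕ)
open import Data.Product using (Σ; ∃; _×_; _,_)
open import Data.Sum using (_⊎_)
open import Data.Empty using (⊥)
open import Relation.Nullary using (¬_)
open import Relation.Binary.PropositionalEquality using (_≡_; _≢_)

record Graph : Set₁ where
  field
    order : ℕ
    Adj   : Fin order → Fin order → Set
    sym   : ∀ {u v} → Adj u v → Adj v u
    irrefl : ∀ {u} → ¬ Adj u u
open Graph public

VSet : Graph → Set₁
VSet G = Fin (order G) → Set

module _ (G : Graph) where

  Dominating : VSet G → Set
  Dominating S = ∀ v → ¬ S v → ∃ λ u → S u × Adj G v u

  AtMostOneNbr : VSet G → Set
  AtMostOneNbr S = ∀ v → ¬ S v → ∀ u w → S u → Adj G v u → S w → Adj G v w → u ≡ w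

  PerfectDominating : VSet G → Set
  PerfectDominating S =
    ∀ v → ¬ S v → ∃ λ u → S u × Adj G v u × (∀ w → S w → Adj G v w → w ≡ u)

  Disjoint : VSet G → VSet G → Set
  Disjoint A B = ∀ v → A v → B v → ⊥

  PerfectCoalition : VSet G → VSet G → Set
  PerfectCoalition A B =
    Disjoint A B × ¬ Dominating A × ¬ Dominating B ×
    AtMostOneNbr A × AtMostOneNbr B ×
    PerfectDominating (λ v → A v ⊎ B v)

  IsSingleton : VSet G → Set
  IsSingleton S = ∃ λ v → S v × (∀ w → S w → w ≡ v)

  record Partition (k : ℕ) : Set where
    field
      cls  : Fin (order G) → Fin k
      surj : ∀ i → ∃ λ v → cls v ≡ i
    Class : Fin k → VSet G
    Class i v = cls v ≡ i

  IsPRCPartition : ∀ {k} → Partition k → Set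
  IsPRCPartition {k} π =
    ∀ i → (IsSingleton (Class i) × Dominating (Class i))
          ⊎ (∃ λ j → i ≢ j × PerfectCoalition (Class i) (Class j))
    where open Partition π

  HasPRCPartition : ℕ → Set
  HasPRCPartition k = Σ (Partition k) IsPRCPartition

  PRC≡ : ℕ → Set
  PRC≡ m =
    (HasPRCPartition m × (∀ k → HasPRCPartition k → k ≤ m))
    ⊎ (m ≡ 0 × (∀ k → ¬ HasPRCPartition k))

PathAdj : (n : ℕ) → Fin n → Fin n → Set
PathAdj n u v = (suc (toℕ u) ≡ toℕ v) ⊎ (suc (toℕ v) ≡ toℕ u)

private
  n≢1+n : ∀ m → ¬ (suc m ≡ m)
  n≢1+n zero ()
  n≢1+n (suc m) p = n≢1+n m (Data.Nat.Properties.suc-injective p)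
    where import Data.Nat.Properties

  swap : ∀ {A B : Set} → A ⊎ B → B ⊎ A
  swap (Data.Sum.inj₁ a) = Data.Sum.inj₂ a
  swap (Data.Sum.inj₂ b) = Data.Sum.inj₁ b

  irr : ∀ n {u : Fin n} → ¬ PathAdj n u u
  irr n {u} (Data.Sum.inj₁ p) = n≢1+n (toℕ u) p
  irr n {u} (Data.Sum.inj₂ p) = n≢1+n (toℕ u) p

P : ℕ → Graph
P n = record { order = n ; Adj = PathAdj n ; sym = swap ; irrefl = irr n }

prcPath : ℕ → ℕ
prcPath 1  = 1
prcPath 2  = 2
prcPath 3  = 0
prcPath 4  = 4
prcPath 5  = 3
prcPath 6  = 4
prcPath 7  = 5
prcPath 8  = 4
prcPath 9  = 5
prcPath 10 = 5
prcPath 11 = 5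
prcPath 13 = 5
prcPath _  = 6

-- Label every vertex of P_n by its class. Domination, "at most one neighbour" and perfect
-- domination of a union of classes are conditions on windows of three consecutive labels,
-- so being a prc-partition is a Boolean property of a word over the labels.
--
-- Upper bound. For n ≥ 4 no singleton dominates, so every class has a perfect-coalition
-- partner. A class h has at most two partners: take a vertex y that h does not dominate;
-- every partner occurs in {y-1, y, y+1}, and three partners a, b, l (a at y, b at y+1)
-- would force the labels a b l a b l … up to the end of the path, where domination fails.
-- Every class contains one of the four end vertices or is a partner of the class of vertex
-- 0 or 1, and a class containing no end vertex can only be a partner of the class of one of
-- the last two vertices; counting gives at most 6 classes. The sizes 3 ≤ n ≤ 13 are settled
-- by an exhaustive search over restricted-growth words, pruned by the window conditions.
--
-- Lower bound. Explicit labellings for n ≤ 13, and for n ≥ 14 two labellings that repeat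
-- 0 1 1 0 after a fixed prefix, one for each parity of n.

module Submission where

open import Data.Bool using (Bool; true; false; T; not; _∧_; _∨_; if_then_else_)
open import Data.Bool.Properties using (T?)
open import Data.Empty using (⊥; ⊥-elim)
open import Data.Fin using (Fin; toℕ; fromℕ<) renaming (zero to fzero; suc to fsuc; _≟_ to _≟ᶠ_)
open import Data.Fin.Properties using (toℕ<n; toℕ-fromℕ<; fromℕ<-toℕ; toℕ-injective; injective⇒≤)
open import Data.List using (List; []; _∷_; _++_; _ʳ++_; reverse; length)
open import Data.List.Properties using (ʳ++-defn; ++-identityʳ; ++-assoc; reverse-involutive; length-reverse; length-++)
open import Data.List.Relation.Unary.Any using (here; there)
open import Data.List.Membership.Propositional.Properties using (∈-++⁺ˡ; ∈-++⁺ʳ)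
import Data.List.Membership.Propositional as ℕMembership
open import Data.Nat using (ℕ; zero; suc; _+_; _*_; _≤_; _<_; z≤n; s≤s; s≤s⁻¹; _≡ᵇ_; _<ᵇ_; _≤ᵇ_; _≟_; _≤?_; _<?_)
open import Data.Nat.Properties
  using (≤-refl; ≤-reflexive; ≤-trans; ≤-antisym; <-irrefl; <-trans; <⇒≤; <⇒≢; ≤∧≢⇒<; ≮⇒≥; ≰⇒>; n≤1+n; m≤n⇒m≤1+n;
         m≤n⇒m<n∨m≡n; m≤m+n; m≤n⇒∃[o]m+o≡n; suc-injective; +-comm; +-suc; +-identityʳ; +-mono-≤; +-monoʳ-≤;
         ≡ᵇ⇒≡; ≡⇒≡ᵇ; <ᵇ⇒<; <⇒<ᵇ; ≤ᵇ⇒≤; ≤⇒≤ᵇ)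
open import Data.Product using (∃; _×_; _,_; proj₁; proj₂)
open import Data.Sum using (_⊎_; inj₁; inj₂; [_,_]; map)
open import Data.Unit using (⊤; tt)
open import Function using (_∘_; Equivalence; _⇔_; mk⇔)
open import Relation.Nullary using (¬_; yes; no; contradiction)
open import Relation.Binary.PropositionalEquality hiding ([_])
open import Defs hiding (sym)

open Equivalence using (to; from)

∧-intro : ∀ {a b} → T a → T b → T (a ∧ b)
∧-intro {true} _ q = q

∧-elim : ∀ a {b} → T (a ∧ b) → T a × T b
∧-elim true q = tt , q

∨-introˡ : ∀ {a} b → T a → T (a ∨ b)
∨-introˡ {true} _ _ = tt

∨-introʳ : ∀ a {b} → T b → T (a ∨ b)
∨-introʳ true  _ = tt
∨-introʳ false q = q

∨-elim : ∀ a {b} → T (a ∨ b) → T a ⊎ T b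
∨-elim true  _ = inj₁ tt
∨-elim false q = inj₂ q

not-intro : ∀ a → ¬ T a → T (not a)
not-intro true  ¬a = ¬a tt
not-intro false _  = tt

not-elim : ∀ a → T (not a) → ¬ T a
not-elim true ()

allBelow : ℕ → (ℕ → Bool) → Bool
allBelow zero    f = true
allBelow (suc k) f = f k ∧ allBelow k f

anyBelow : ℕ → (ℕ → Bool) → Bool
anyBelow zero    f = false
anyBelow (suc k) f = f k ∨ anyBelow k f

allBelow⁺ : ∀ k f → (∀ j → j < k → T (f j)) → T (allBelow k f)
allBelow⁺ zero    f h = tt
allBelow⁺ (suc k) f h = ∧-intro (h k ≤-refl) (allBelow⁺ k f λ j j<k → h j (≤-trans j<k (n≤1+n k)))

allBelow⁻ : ∀ k f → T (allBelow k f) → ∀ j → j < k → T (f j)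
allBelow⁻ (suc k) f h j (s≤s j≤k) with ∧-elim (f k) h | m≤n⇒m<n∨m≡n j≤k
... | _  , fs | inj₁ j<k  = allBelow⁻ k f fs j j<k
... | fk , _  | inj₂ refl = fk

¬allBelow⁻ : ∀ k f → ¬ T (allBelow k f) → ∃ λ j → j < k × ¬ T (f j)
¬allBelow⁻ zero    f ¬all = contradiction tt ¬all
¬allBelow⁻ (suc k) f ¬all with T? (f k)
... | no ¬fk = k , ≤-refl , ¬fk
... | yes fk with ¬allBelow⁻ k f (¬all ∘ ∧-intro fk)
...   | j , j<k , ¬fj = j , ≤-trans j<k (n≤1+n k) , ¬fj

anyBelow⁺ : ∀ k f j → j < k → T (f j) → T (anyBelow k f)
anyBelow⁺ (suc k) f j (s≤s j≤k) fj with m≤n⇒m<n∨m≡n j≤k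
... | inj₁ j<k  = ∨-introʳ (f k) (anyBelow⁺ k f j j<k fj)
... | inj₂ refl = ∨-introˡ (anyBelow k f) fj

anyBelow⁻ : ∀ k f → T (anyBelow k f) → ∃ λ j → j < k × T (f j)
anyBelow⁻ (suc k) f h with ∨-elim (f k) h
... | inj₁ fk  = k , ≤-refl , fk
... | inj₂ fs with anyBelow⁻ k f fs
...   | j , j<k , fj = j , ≤-trans j<k (n≤1+n k) , fj

-- Domination on a path, window by window

module _ (G : Graph) {S : VSet G} where

  perfect⇒dominating : PerfectDominating G S → Dominating G S
  perfect⇒dominating pd v ¬Sv with pd v ¬Sv
  ... | u , Su , adj , _ = u , Su , adj

  perfect⇒atMostOne : PerfectDominating G S → AtMostOneNbr G S
  perfect⇒atMostOne pd v ¬Sv u w Su vu Sw vw with pd v ¬Sv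
  ... | _ , _ , _ , unique = trans (unique u Su vu) (sym (unique w Sw vw))

  dominating×atMostOne⇒perfect : Dominating G S → AtMostOneNbr G S → PerfectDominating G S
  dominating×atMostOne⇒perfect dom amo v ¬Sv with dom v ¬Sv
  ... | u , Su , vu = u , Su , vu , λ w Sw vw → amo v ¬Sv w u Sw vw Su vu

Window : Set
Window = Bool → Bool → Bool → Bool

dominatedW atMostOneW : Window
dominatedW l x r = x ∨ (l ∨ r)
atMostOneW l x r = x ∨ not (l ∧ r)

window-cong : ∀ (F : Window) {l l′ x x′ r r′} → l ≡ l′ → x ≡ x′ → r ≡ r′ → F l x r ≡ F l′ x′ r′
window-cong F refl refl refl = refl

leftOf : (ℕ → Bool) → ℕ → Bool
leftOf s zero    = false
leftOf s (suc t) = s t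

windowAt : Window → (ℕ → Bool) → ℕ → Bool
windowAt F s t = F (leftOf s t) (s t) (s (suc t))

holdsOnPath : ℕ → Window → (ℕ → Bool) → Bool
holdsOnPath n F s = allBelow n (windowAt F s)

record Characterises (n : ℕ) (A : VSet (P n)) (s : ℕ → Bool) : Set where
  field
    ∈⇒    : ∀ {v} → A v → T (s (toℕ v))
    ⇒∈    : ∀ {v} → T (s (toℕ v)) → A v
    bound : ∀ {t} → T (s t) → t < n

module _ {n : ℕ} {A : VSet (P n)} {s : ℕ → Bool} (χ : Characterises n A s) where
  open Characterises χ

  private
    vertexAt : ∀ {t} → T (s t) → ∃ λ u → A u × toℕ u ≡ t
    vertexAt st = fromℕ< (bound st) , ⇒∈ (subst (T ∘ s) (sym (toℕ-fromℕ< (bound st))) st) , toℕ-fromℕ< (bound st)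

    rightNbr : ∀ (v : Fin n) → T (s (suc (toℕ v))) → ∃ λ u → A u × suc (toℕ v) ≡ toℕ u
    rightNbr v sv₊ with vertexAt sv₊
    ... | u , Au , u≡ = u , Au , sym u≡

    leftNbr : ∀ (v : Fin n) → T (leftOf s (toℕ v)) → ∃ λ u → A u × suc (toℕ u) ≡ toℕ v
    leftNbr v sv₋ = go (toℕ v) refl sv₋
      where
        go : ∀ t → toℕ v ≡ t → T (leftOf s t) → ∃ λ u → A u × suc (toℕ u) ≡ toℕ v
        go (suc t) v≡ st with vertexAt st
        ... | u , Au , u≡ = u , Au , trans (cong suc u≡) (sym v≡)

    leftIn : ∀ {u v : Fin n} → A u → suc (toℕ u) ≡ toℕ v → T (leftOf s (toℕ v))
    leftIn Au u₊≡v = subst (T ∘ leftOf s) u₊≡v (∈⇒ Au)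

    rightIn : ∀ {u v : Fin n} → A u → suc (toℕ v) ≡ toℕ u → T (s (suc (toℕ v)))
    rightIn Au v₊≡u = subst (T ∘ s) (sym v₊≡u) (∈⇒ Au)

    dominating⇒ : Dominating (P n) A → ∀ (v : Fin n) → T (windowAt dominatedW s (toℕ v))
    dominating⇒ dom v with T? (s (toℕ v))
    ... | yes sv = ∨-introˡ _ sv
    ... | no ¬sv with dom v (¬sv ∘ ∈⇒)
    ...   | u , Au , inj₁ v₊≡u = ∨-introʳ (s (toℕ v)) (∨-introʳ (leftOf s (toℕ v)) (rightIn Au v₊≡u))
    ...   | u , Au , inj₂ u₊≡v = ∨-introʳ (s (toℕ v)) (∨-introˡ (s (suc (toℕ v))) (leftIn Au u₊≡v))

    dominating⇐ : (∀ (v : Fin n) → T (windowAt dominatedW s (toℕ v))) → Dominating (P n) A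
    dominating⇐ w v ¬Av with ∨-elim (s (toℕ v)) (w v)
    ... | inj₁ sv = contradiction (⇒∈ sv) ¬Av
    ... | inj₂ lr with ∨-elim (leftOf s (toℕ v)) lr
    ...   | inj₁ l = let u , Au , u₊≡v = leftNbr v l in u , Au , inj₂ u₊≡v
    ...   | inj₂ r = let u , Au , v₊≡u = rightNbr v r in u , Au , inj₁ v₊≡u

    bothSides : ∀ {v u w : Fin n} → ¬ A v → (∀ (v : Fin n) → T (windowAt atMostOneW s (toℕ v))) →
                A u → suc (toℕ u) ≡ toℕ v → A w → suc (toℕ v) ≡ toℕ w → ⊥
    bothSides {v} ¬Av h Au u₊≡v Aw v₊≡w with ∨-elim (s (toℕ v)) (h v)
    ... | inj₁ sv   = ¬Av (⇒∈ sv)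
    ... | inj₂ ¬l∧r = not-elim _ ¬l∧r (∧-intro (leftIn Au u₊≡v) (rightIn Aw v₊≡w))

    atMostOne⇒ : AtMostOneNbr (P n) A → ∀ (v : Fin n) → T (windowAt atMostOneW s (toℕ v))
    atMostOne⇒ amo v with T? (s (toℕ v))
    ... | yes sv = ∨-introˡ _ sv
    ... | no ¬sv = ∨-introʳ (s (toℕ v)) (not-intro _ twoNbrs)
      where
        twoNbrs : ¬ T (leftOf s (toℕ v) ∧ s (suc (toℕ v)))
        twoNbrs l∧r with ∧-elim (leftOf s (toℕ v)) l∧r
        ... | l , r with leftNbr v l | rightNbr v r
        ...   | u , Au , u₊≡v | w , Aw , v₊≡w =
          <⇒≢ u<w (cong toℕ (amo v (¬sv ∘ ∈⇒) u w Au (inj₂ u₊≡v) Aw (inj₁ v₊≡w)))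
          where
            u<w : toℕ u < toℕ w
            u<w rewrite sym v₊≡w | sym u₊≡v = n≤1+n (suc (toℕ u))

    atMostOne⇐ : (∀ (v : Fin n) → T (windowAt atMostOneW s (toℕ v))) → AtMostOneNbr (P n) A
    atMostOne⇐ h v ¬Av u w Au (inj₁ v₊≡u) Aw (inj₁ v₊≡w) = toℕ-injective (trans (sym v₊≡u) v₊≡w)
    atMostOne⇐ h v ¬Av u w Au (inj₂ u₊≡v) Aw (inj₂ w₊≡v) = toℕ-injective (suc-injective (trans u₊≡v (sym w₊≡v)))
    atMostOne⇐ h v ¬Av u w Au (inj₁ v₊≡u) Aw (inj₂ w₊≡v) = ⊥-elim (bothSides ¬Av h Aw w₊≡v Au v₊≡u)
    atMostOne⇐ h v ¬Av u w Au (inj₂ u₊≡v) Aw (inj₁ v₊≡w) = ⊥-elim (bothSides ¬Av h Au u₊≡v Aw v₊≡w)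

    atVertices : ∀ f → T (allBelow n f) → ∀ (v : Fin n) → T (f (toℕ v))
    atVertices f h v = allBelow⁻ n f h (toℕ v) (toℕ<n v)

    atPositions : ∀ f → (∀ (v : Fin n) → T (f (toℕ v))) → T (allBelow n f)
    atPositions f h = allBelow⁺ n f λ t t<n → subst (T ∘ f) (toℕ-fromℕ< t<n) (h (fromℕ< t<n))

  dominating⇔ : Dominating (P n) A ⇔ T (holdsOnPath n dominatedW s)
  dominating⇔ = mk⇔ (atPositions _ ∘ dominating⇒) (dominating⇐ ∘ atVertices _)

  atMostOne⇔ : AtMostOneNbr (P n) A ⇔ T (holdsOnPath n atMostOneW s)
  atMostOne⇔ = mk⇔ (atPositions _ ∘ atMostOne⇒) (atMostOne⇐ ∘ atVertices _)

countBelow : ℕ → (ℕ → Bool) → ℕ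
countBelow zero    f = 0
countBelow (suc k) f = if f k then suc (countBelow k f) else countBelow k f

module _ {f : ℕ → Bool} where

  private
    weaken : ∀ {k} {Q : ℕ → Set} → (∀ j → j < suc k → Q j) → ∀ j → j < k → Q j
    weaken {k} h j j<k = h j (≤-trans j<k (n≤1+n k))

  countBelow-all : ∀ k → (∀ j → j < k → T (f j)) → k ≤ countBelow k f
  countBelow-all zero    h = z≤n
  countBelow-all (suc k) h with f k | h k ≤-refl
  ... | true | _ = s≤s (countBelow-all k (weaken h))

  countBelow-none : ∀ k → (∀ j → j < k → ¬ T (f j)) → countBelow k f ≡ 0
  countBelow-none zero    h = refl
  countBelow-none (suc k) h with f k in fk≡
  ... | true  = contradiction (subst T (sym fk≡) tt) (h k ≤-refl)
  ... | false = countBelow-none k (weaken h)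

  countBelow-pick : ∀ k c → suc c ≤ countBelow k f → ∃ λ j → j < k × T (f j) × c ≤ countBelow j f
  countBelow-pick (suc k) c h with f k in fk≡
  ... | true  = k , ≤-refl , subst T (sym fk≡) tt , s≤s⁻¹ h
  ... | false with countBelow-pick k c h
  ...   | j , j<k , fj , c≤ = j , ≤-trans j<k (n≤1+n k) , fj , c≤

  countBelow≤1 : ∀ k → (∀ j j′ → j′ < j → j < k → T (f j) → T (f j′) → ⊥) → countBelow k f ≤ 1
  countBelow≤1 k one with countBelow k f ≤? 1
  ... | yes c≤1 = c≤1
  ... | no c≰1 with countBelow-pick k 1 (≰⇒> c≰1)
  ...   | j , j<k , fj , 1≤ with countBelow-pick j 0 1≤
  ...     | j′ , j′<j , fj′ , _ = ⊥-elim (one j j′ j′<j j<k fj fj′)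

  countBelow≤2 : ∀ k → (∀ j j′ j″ → j″ < j′ → j′ < j → j < k → T (f j) → T (f j′) → T (f j″) → ⊥) →
                 countBelow k f ≤ 2
  countBelow≤2 k two with countBelow k f ≤? 2
  ... | yes c≤2 = c≤2
  ... | no c≰2 with countBelow-pick k 2 (≰⇒> c≰2)
  ...   | j , j<k , fj , 2≤ with countBelow-pick j 1 2≤
  ...     | j′ , j′<j , fj′ , 1≤ with countBelow-pick j′ 0 1≤
  ...       | j″ , j″<j′ , fj″ , _ = ⊥-elim (two j j′ j″ j″<j′ j′<j j<k fj fj′ fj″)

  countBelow-witness : ∀ k j → j < k → T (f j) → 1 ≤ countBelow k f
  countBelow-witness (suc k) j (s≤s j≤k) fj with f k in fk≡ | m≤n⇒m<n∨m≡n j≤k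
  ... | true  | _         = s≤s z≤n
  ... | false | inj₁ j<k  = countBelow-witness k j j<k fj
  ... | false | inj₂ refl = ⊥-elim (subst T fk≡ fj)

  countBelow-mono : ∀ {f′} k → (∀ j → j < k → T (f j) → T (f′ j)) → countBelow k f ≤ countBelow k f′
  countBelow-mono         zero    h = z≤n
  countBelow-mono {f′} (suc k) h with f k in fk≡ | f′ k in f′k≡
  ... | true  | true  = s≤s (countBelow-mono k (weaken h))
  ... | true  | false = ⊥-elim (subst T f′k≡ (h k ≤-refl (subst T (sym fk≡) tt)))
  ... | false | true  = m≤n⇒m≤1+n (countBelow-mono k (weaken h))
  ... | false | false = countBelow-mono k (weaken h)

countBelow-∨ : ∀ k f f′ → countBelow k (λ j → f j ∨ f′ j) ≤ countBelow k f + countBelow k f′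
countBelow-∨ zero    f f′ = z≤n
countBelow-∨ (suc k) f f′ with f k | f′ k | countBelow-∨ k f f′
... | true  | true  | ih = s≤s (≤-trans ih (+-monoʳ-≤ (countBelow k f) (n≤1+n _)))
... | true  | false | ih = s≤s ih
... | false | true  | ih = ≤-trans (s≤s ih) (≤-reflexive (sym (+-suc (countBelow k f) (countBelow k f′))))
... | false | false | ih = ih

-- Labelled words and the search

select : ℕ → (ℕ → ℕ) → (ℕ → Bool) → ℕ → Bool
select n g m t = (t <ᵇ n) ∧ m (g t)

select-< : ∀ {n t} g m → t < n → select n g m t ≡ m (g t)
select-< {n} {t} g m t<n with t <ᵇ n | <⇒<ᵇ t<n
... | true | _ = refl

select-n : ∀ n g m → select n g m n ≡ false
select-n n g m with n <ᵇ n | <ᵇ⇒< n n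
... | false | _   = refl
... | true  | n<n = ⊥-elim (<-irrefl refl (n<n tt))

-- A word lists the labels of the vertices n-1, …, 1, 0, so that the search extends it with ∷.
build : ℕ → (ℕ → ℕ) → List ℕ
build zero    g = []
build (suc n) g = g n ∷ build n g

length-build : ∀ n g → length (build n g) ≡ n
length-build zero    g = refl
length-build (suc n) g = cong suc (length-build n g)

headIn : (ℕ → Bool) → List ℕ → Bool
headIn m []      = false
headIn m (x ∷ _) = m x

windowsFrom : Window → (ℕ → Bool) → Bool → List ℕ → Bool
windowsFrom F m r []      = true
windowsFrom F m r (x ∷ w) = F (headIn m w) (m x) r ∧ windowsFrom F m (m x) w

holdsOnWord : Window → (ℕ → Bool) → List ℕ → Bool
holdsOnWord F m = windowsFrom F m false

-- The windows of all letters except the head, whose other neighbour is not chosen yet.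
holdsBelowHead : Window → (ℕ → Bool) → List ℕ → Bool
holdsBelowHead F m []      = true
holdsBelowHead F m (x ∷ w) = windowsFrom F m (m x) w

holdsOnWord⇒holdsBelowHead : ∀ F m w → T (holdsOnWord F m w) → T (holdsBelowHead F m w)
holdsOnWord⇒holdsBelowHead F m []      _ = tt
holdsOnWord⇒holdsBelowHead F m (x ∷ w) h = proj₂ (∧-elim (F (headIn m w) (m x) false) h)

holdsBelowHead-∷ : ∀ F m y w → T (holdsBelowHead F m (y ∷ w)) → T (holdsBelowHead F m w)
holdsBelowHead-∷ F m y []      _ = tt
holdsBelowHead-∷ F m y (x ∷ w) h = proj₂ (∧-elim (F (headIn m w) (m x) (m y)) h)

module _ (n : ℕ) (g : ℕ → ℕ) (F : Window) (m : ℕ → Bool) where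
  private
    s = select n g m

    headIn-build : ∀ j → j ≤ n → headIn m (build j g) ≡ leftOf s j
    headIn-build zero    _     = refl
    headIn-build (suc i) i<n = sym (select-< g m i<n)

    windowsFrom-build : ∀ j → j ≤ n → windowsFrom F m (s j) (build j g) ≡ allBelow j (windowAt F s)
    windowsFrom-build zero    _   = refl
    windowsFrom-build (suc j) j<n =
      cong₂ _∧_ (window-cong F (headIn-build j (<⇒≤ j<n)) atJ refl)
                (trans (cong (λ r → windowsFrom F m r (build j g)) atJ) (windowsFrom-build j (<⇒≤ j<n)))
      where
        atJ : m (g j) ≡ s j
        atJ = sym (select-< g m j<n)

  holdsOnWord-build : holdsOnWord F m (build n g) ≡ holdsOnPath n F s
  holdsOnWord-build = trans (cong (λ r → windowsFrom F m r (build n g)) (sym (select-n n g m))) (windowsFrom-build n ≤-refl)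

nextCount : ℕ → ℕ → ℕ
nextCount x K = if x ≡ᵇ K then suc K else K

labelCount : List ℕ → ℕ
labelCount []      = 0
labelCount (x ∷ w) = nextCount x (labelCount w)

-- Restricted-growth words: one representative for each partition of the path up to renaming
-- the classes.
RestrictedGrowth : List ℕ → Set
RestrictedGrowth []      = ⊤
RestrictedGrowth (x ∷ w) = x ≤ labelCount w × RestrictedGrowth w

K≤nextCount : ∀ x K → K ≤ nextCount x K
K≤nextCount x K with x ≡ᵇ K
... | true  = n≤1+n K
... | false = ≤-refl

labelCount-ʳ++ : ∀ q s → labelCount s ≤ labelCount (q ʳ++ s)
labelCount-ʳ++ []      s = ≤-refl
labelCount-ʳ++ (y ∷ q) s = ≤-trans (K≤nextCount y (labelCount s)) (labelCount-ʳ++ q (y ∷ s))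

RestrictedGrowth-ʳ++ : ∀ q s → RestrictedGrowth (q ʳ++ s) → RestrictedGrowth s
RestrictedGrowth-ʳ++ []      s rg = rg
RestrictedGrowth-ʳ++ (y ∷ q) s rg = proj₂ (RestrictedGrowth-ʳ++ q (y ∷ s) rg)

search : (prune accept : List ℕ → Bool) → ℕ → ℕ → List ℕ → Bool
search prune accept k zero    w = (labelCount w ≡ᵇ k) ∧ accept w
search prune accept k (suc t) w = anyBelow (suc (labelCount w)) λ x →
  (labelCount (x ∷ w) ≤ᵇ k) ∧ (prune (x ∷ w) ∧ search prune accept k t (x ∷ w))

search-complete : ∀ prune accept k w → RestrictedGrowth w → labelCount w ≡ k → T (accept w) →
                  (∀ q x s → w ≡ q ʳ++ x ∷ s → T (prune (x ∷ s))) →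
                  T (search prune accept k (length w) [])
search-complete prune accept k w rg count acc pruned =
  subst (λ t → T (search prune accept k t [])) (length-reverse w) (completes (reverse w) [] w≡)
  where
    w≡ : w ≡ reverse w ʳ++ []
    w≡ = sym (trans (ʳ++-defn (reverse w)) (trans (++-identityʳ _) (reverse-involutive w)))

    completes : ∀ q s → w ≡ q ʳ++ s → T (search prune accept k (length q) s)
    completes []      s refl = ∧-intro (≡⇒≡ᵇ _ _ count) acc
    completes (x ∷ q) s w≡ =
      anyBelow⁺ (suc (labelCount s)) _ x (s≤s (proj₁ (RestrictedGrowth-ʳ++ q (x ∷ s) (subst RestrictedGrowth w≡ rg))))
        (∧-intro (≤⇒≤ᵇ (subst (labelCount (x ∷ s) ≤_) (trans (cong labelCount (sym w≡)) count)
                                (labelCount-ʳ++ q (x ∷ s))))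
          (∧-intro (pruned q x s w≡) (completes q (x ∷ s) w≡)))

isLabel : ℕ → ℕ → Bool
isLabel j x = x ≡ᵇ j

inPair : ℕ → ℕ → ℕ → Bool
inPair j j′ x = (x ≡ᵇ j) ∨ (x ≡ᵇ j′)

Test : Set
Test = Window → (ℕ → Bool) → Bool

onWord : List ℕ → Test
onWord w F m = holdsOnWord F m w

belowHead : List ℕ → Test
belowHead w F m = holdsBelowHead F m w

onPath : ℕ → (ℕ → ℕ) → Test
onPath n g F m = holdsOnPath n F (select n g m)

localCoalition : Test → ℕ → ℕ → Bool
localCoalition holds j j′ =
  holds dominatedW (inPair j j′) ∧ (holds atMostOneW (inPair j j′) ∧
  (holds atMostOneW (isLabel j) ∧ holds atMostOneW (isLabel j′)))

coalition : Test → ℕ → ℕ → Bool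
coalition holds j j′ =
  localCoalition holds j j′ ∧
  (not (holds dominatedW (isLabel j)) ∧ not (holds dominatedW (isLabel j′)))

hasPartner : ℕ → (ℕ → ℕ → Bool) → ℕ → Bool
hasPartner k C j = anyBelow k λ j′ → not (j ≡ᵇ j′) ∧ C j j′

paired : ℕ → (ℕ → ℕ → Bool) → Bool
paired k C = allBelow k (hasPartner k C)

occurrences : (ℕ → Bool) → List ℕ → ℕ
occurrences m []      = 0
occurrences m (x ∷ w) = if m x then suc (occurrences m w) else occurrences m w

occurrences-build : ∀ m n g → occurrences m (build n g) ≡ countBelow n (m ∘ g)
occurrences-build m zero    g = refl
occurrences-build m (suc n) g = cong (λ c → if m (g n) then suc c else c) (occurrences-build m n g)

singletonDominating : List ℕ → ℕ → Bool
singletonDominating w j = (occurrences (isLabel j) w ≡ᵇ 1) ∧ holdsOnWord dominatedW (isLabel j) w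

prcWord : ℕ → List ℕ → Bool
prcWord k w = allBelow k λ j →
  singletonDominating w j ∨ hasPartner k (coalition (onWord w)) j

CoalitionFacts : Test → ℕ → ℕ → Set
CoalitionFacts H j j′ =
  T (H dominatedW (inPair j j′)) × T (H atMostOneW (inPair j j′)) ×
  T (H atMostOneW (isLabel j)) × T (H atMostOneW (isLabel j′)) ×
  ¬ T (H dominatedW (isLabel j)) × ¬ T (H dominatedW (isLabel j′))

coalition⇔ : ∀ H j j′ → T (coalition H j j′) ⇔ CoalitionFacts H j j′
coalition⇔ H j j′ = mk⇔ split join
  where
    split : T (coalition H j j′) → CoalitionFacts H j j′
    split h with ∧-elim (localCoalition H j j′) h
    ... | loc , nd with ∧-elim (H dominatedW (inPair j j′)) loc | ∧-elim (not (H dominatedW (isLabel j))) nd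
    ...   | d , amos | nd₁ , nd₂ with ∧-elim (H atMostOneW (inPair j j′)) amos
    ...     | a , a₁₂ with ∧-elim (H atMostOneW (isLabel j)) a₁₂
    ...       | a₁ , a₂ = d , a , a₁ , a₂ , not-elim _ nd₁ , not-elim _ nd₂
    join : CoalitionFacts H j j′ → T (coalition H j j′)
    join (d , a , a₁ , a₂ , nd₁ , nd₂) =
      ∧-intro (∧-intro d (∧-intro a (∧-intro a₁ a₂))) (∧-intro (not-intro _ nd₁) (not-intro _ nd₂))

localCoalition-mono : ∀ {H H′} → (∀ F m → T (H F m) → T (H′ F m)) →
                      ∀ j j′ → T (localCoalition H j j′) → T (localCoalition H′ j j′)
localCoalition-mono {H} H⇒H′ j j′ h with ∧-elim (H dominatedW (inPair j j′)) h
... | d , h₁ with ∧-elim (H atMostOneW (inPair j j′)) h₁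
...   | a , h₂ with ∧-elim (H atMostOneW (isLabel j)) h₂
...     | a₁ , a₂ = ∧-intro (H⇒H′ _ _ d) (∧-intro (H⇒H′ _ _ a) (∧-intro (H⇒H′ _ _ a₁) (H⇒H′ _ _ a₂)))

coalition-cong : ∀ {H H′} → (∀ F m → H F m ≡ H′ F m) → ∀ j j′ → coalition H j j′ ≡ coalition H′ j j′
coalition-cong H≡H′ j j′ =
  cong₂ _∧_ (cong₂ _∧_ (H≡H′ _ _) (cong₂ _∧_ (H≡H′ _ _) (cong₂ _∧_ (H≡H′ _ _) (H≡H′ _ _))))
            (cong₂ _∧_ (cong not (H≡H′ _ _)) (cong not (H≡H′ _ _)))

coalition⇒localCoalition : ∀ H j j′ → T (coalition H j j′) → T (localCoalition H j j′)
coalition⇒localCoalition H j j′ = proj₁ ∘ ∧-elim (localCoalition H j j′)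

hasPartner-mono : ∀ {k C C′} → (∀ j j′ → T (C j j′) → T (C′ j j′)) →
                  ∀ j → T (hasPartner k C j) → T (hasPartner k C′ j)
hasPartner-mono {k} {C} C⇒C′ j h with anyBelow⁻ k _ h
... | j′ , j′<k , ne∧c with ∧-elim (not (j ≡ᵇ j′)) ne∧c
...   | ne , c = anyBelow⁺ k _ j′ j′<k (∧-intro ne (C⇒C′ j j′ c))

paired-mono : ∀ {k C C′} → (∀ j j′ → T (C j j′) → T (C′ j j′)) → T (paired k C) → T (paired k C′)
paired-mono {k} C⇒C′ h = allBelow⁺ k _ λ j j<k → hasPartner-mono {k} C⇒C′ j (allBelow⁻ k _ h j j<k)

onWord-ʳ++⇒belowHead : ∀ q x s F m → T (onWord (q ʳ++ x ∷ s) F m) → T (belowHead (x ∷ s) F m)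
onWord-ʳ++⇒belowHead []      x s F m h = holdsOnWord⇒holdsBelowHead F m (x ∷ s) h
onWord-ʳ++⇒belowHead (y ∷ q) x s F m h = holdsBelowHead-∷ F m y (x ∷ s) (onWord-ʳ++⇒belowHead q y (x ∷ s) F m h)

-- Partitions as labellings

record Labelling {n k : ℕ} (cls : Fin n → Fin k) (lab : ℕ → ℕ) : Set where
  field
    rank           : Fin k → ℕ
    rank-injective : ∀ {i i′} → rank i ≡ rank i′ → i ≡ i′
    lab≡rank       : ∀ v → lab (toℕ v) ≡ rank (cls v)

module _ {n k : ℕ} {cls : Fin n → Fin k} {lab : ℕ → ℕ} (L : Labelling cls lab) where
  open Labelling L

  private
    Class : Fin k → VSet (P n)
    Class i v = cls v ≡ i

    position<n : ∀ {t} b → T ((t <ᵇ n) ∧ b) → t < n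
    position<n {t} b = <ᵇ⇒< t n ∘ proj₁ ∘ ∧-elim (t <ᵇ n)

  class-χ : ∀ i → Characterises n (Class i) (select n lab (isLabel (rank i)))
  class-χ i = record
    { ∈⇒ = λ {v} cv≡i → ∧-intro (<⇒<ᵇ (toℕ<n v)) (≡⇒≡ᵇ _ _ (trans (lab≡rank v) (cong rank cv≡i)))
    ; ⇒∈ = λ {v} h → rank-injective (trans (sym (lab≡rank v)) (≡ᵇ⇒≡ _ _ (proj₂ (∧-elim (toℕ v <ᵇ n) h))))
    ; bound = position<n _
    }

  pair-χ : ∀ i i′ → Characterises n (λ v → Class i v ⊎ Class i′ v) (select n lab (inPair (rank i) (rank i′)))
  pair-χ i i′ = record
    { ∈⇒ = λ {v} → ∧-intro (<⇒<ᵇ (toℕ<n v)) ∘ label∈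
    ; ⇒∈ = λ {v} h → ∈label v (proj₂ (∧-elim (toℕ v <ᵇ n) h))
    ; bound = position<n _
    }
    where
      label∈ : ∀ {v} → Class i v ⊎ Class i′ v → T (inPair (rank i) (rank i′) (lab (toℕ v)))
      label∈ {v} (inj₁ cv≡i)  = ∨-introˡ _ (≡⇒≡ᵇ _ _ (trans (lab≡rank v) (cong rank cv≡i)))
      label∈ {v} (inj₂ cv≡i′) =
        ∨-introʳ (lab (toℕ v) ≡ᵇ rank i) (≡⇒≡ᵇ _ _ (trans (lab≡rank v) (cong rank cv≡i′)))
      ∈label : ∀ v → T (inPair (rank i) (rank i′) (lab (toℕ v))) → Class i v ⊎ Class i′ v
      ∈label v h with ∨-elim (lab (toℕ v) ≡ᵇ rank i) h
      ... | inj₁ e = inj₁ (rank-injective (trans (sym (lab≡rank v)) (≡ᵇ⇒≡ _ _ e)))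
      ... | inj₂ e = inj₂ (rank-injective (trans (sym (lab≡rank v)) (≡ᵇ⇒≡ _ _ e)))

  coalition⁺ : ∀ i i′ → PerfectCoalition (P n) (Class i) (Class i′) → T (coalition (onPath n lab) (rank i) (rank i′))
  coalition⁺ i i′ (_ , ¬dom , ¬dom′ , amo , amo′ , pd) = from (coalition⇔ (onPath n lab) (rank i) (rank i′))
    ( to (dominating⇔ (pair-χ i i′)) (perfect⇒dominating (P n) pd)
    , to (atMostOne⇔ (pair-χ i i′)) (perfect⇒atMostOne (P n) pd)
    , to (atMostOne⇔ (class-χ i)) amo
    , to (atMostOne⇔ (class-χ i′)) amo′
    , ¬dom ∘ from (dominating⇔ (class-χ i))
    , ¬dom′ ∘ from (dominating⇔ (class-χ i′)) )

  coalition⁻ : ∀ i i′ → i ≢ i′ → T (coalition (onPath n lab) (rank i) (rank i′)) →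
               PerfectCoalition (P n) (Class i) (Class i′)
  coalition⁻ i i′ i≢i′ h with to (coalition⇔ (onPath n lab) (rank i) (rank i′)) h
  ... | d , a , a₁ , a₂ , nd₁ , nd₂ =
    (λ v cv≡i cv≡i′ → i≢i′ (trans (sym cv≡i) cv≡i′))
    , nd₁ ∘ to (dominating⇔ (class-χ i))
    , nd₂ ∘ to (dominating⇔ (class-χ i′))
    , from (atMostOne⇔ (class-χ i)) a₁
    , from (atMostOne⇔ (class-χ i′)) a₂
    , dominating×atMostOne⇒perfect (P n) (from (dominating⇔ (pair-χ i i′)) d) (from (atMostOne⇔ (pair-χ i i′)) a)

  singleton⁺ : ∀ i → IsSingleton (P n) (Class i) → countBelow n (isLabel (rank i) ∘ lab) ≡ 1
  singleton⁺ i (v , cv≡i , unique) = ≤-antisym (countBelow≤1 n distinct) (countBelow-witness n (toℕ v) (toℕ<n v) labelled)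
    where
      labelled : T (isLabel (rank i) (lab (toℕ v)))
      labelled = ≡⇒≡ᵇ _ _ (trans (lab≡rank v) (cong rank cv≡i))
      position≡v : ∀ {t} (t<n : t < n) → T (isLabel (rank i) (lab t)) → t ≡ toℕ v
      position≡v t<n h = trans (sym (toℕ-fromℕ< t<n)) (cong toℕ (unique _ (rank-injective
        (trans (sym (lab≡rank _)) (trans (cong lab (toℕ-fromℕ< t<n)) (≡ᵇ⇒≡ _ _ h))))))
      distinct : ∀ t t′ → t′ < t → t < n → T (isLabel (rank i) (lab t)) → T (isLabel (rank i) (lab t′)) → ⊥
      distinct t t′ t′<t t<n h h′ = <⇒≢ t′<t (trans (position≡v (<-trans t′<t t<n) h′) (sym (position≡v t<n h)))

RestrictedGrowth-onto : ∀ w → RestrictedGrowth w → ∀ {j} → j < labelCount w → j ℕMembership.∈ w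
RestrictedGrowth-onto (x ∷ w) (_ , rg) {j} j< with x ≡ᵇ labelCount w in x≡K
... | false = there (RestrictedGrowth-onto w rg j<)
... | true with m≤n⇒m<n∨m≡n (s≤s⁻¹ j<)
...   | inj₁ j<K  = there (RestrictedGrowth-onto w rg j<K)
...   | inj₂ refl = here (sym (≡ᵇ⇒≡ x _ (subst T (sym x≡K) tt)))

∈-build : ∀ n g {j} → j ℕMembership.∈ build n g → ∃ λ t → t < n × g t ≡ j
∈-build (suc n) g (here j≡)  = n , ≤-refl , sym j≡
∈-build (suc n) g (there j∈) with ∈-build n g j∈
... | t , t<n , gt≡j = t , ≤-trans t<n (n≤1+n n) , gt≡j

module _ {k : ℕ} where
  open import Data.List.Membership.DecPropositional (_≟ᶠ_ {k}) using (_∈_; _∉_; _∈?_)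

  indexIn : List (Fin k) → Fin k → ℕ
  indexIn []       x = 0
  indexIn (y ∷ ys) x with x ≟ᶠ y
  ... | yes _ = 0
  ... | no  _ = suc (indexIn ys x)

  indexIn-++ : ∀ {x} xs ys → x ∈ xs → indexIn (xs ++ ys) x ≡ indexIn xs x
  indexIn-++ {x} (y ∷ xs) ys x∈ with x ≟ᶠ y | x∈
  ... | yes _  | _          = refl
  ... | no x≢y | here x≡y   = contradiction x≡y x≢y
  ... | no _   | there x∈xs = cong suc (indexIn-++ xs ys x∈xs)

  indexIn-< : ∀ {x} xs → x ∈ xs → indexIn xs x < length xs
  indexIn-< {x} (y ∷ xs) x∈ with x ≟ᶠ y | x∈
  ... | yes _  | _          = s≤s z≤n
  ... | no x≢y | here x≡y   = contradiction x≡y x≢y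
  ... | no _   | there x∈xs = s≤s (indexIn-< xs x∈xs)

  indexIn-new : ∀ {x} xs → x ∉ xs → indexIn (xs ++ x ∷ []) x ≡ length xs
  indexIn-new {x} [] _ with x ≟ᶠ x
  ... | yes _   = refl
  ... | no x≢x = contradiction refl x≢x
  indexIn-new {x} (y ∷ xs) x∉ with x ≟ᶠ y
  ... | yes x≡y = contradiction (here x≡y) x∉
  ... | no _    = cong suc (indexIn-new xs (λ x∈ → x∉ (there x∈)))

  indexIn-injective : ∀ {x x′} xs → x ∈ xs → x′ ∈ xs → indexIn xs x ≡ indexIn xs x′ → x ≡ x′
  indexIn-injective {x} {x′} (y ∷ xs) x∈ x′∈ eq with x ≟ᶠ y | x′ ≟ᶠ y | x∈ | x′∈
  ... | yes x≡y | yes x′≡y | _ | _ = trans x≡y (sym x′≡y)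
  ... | no x≢y  | _ | here x≡y | _ = contradiction x≡y x≢y
  ... | _ | no x′≢y | _ | here x′≡y = contradiction x′≡y x′≢y
  ... | no _  | no _  | there x∈xs | there x′∈xs = indexIn-injective xs x∈xs x′∈xs (suc-injective eq)

  module CanonicalLabelling {n : ℕ} (π : Partition (P n) k) (default : Fin k) where
    open Partition π

    classAt : ℕ → Fin k
    classAt t with t <? n
    ... | yes t<n = cls (fromℕ< t<n)
    ... | no  _   = default

    classAt-toℕ : ∀ v → classAt (toℕ v) ≡ cls v
    classAt-toℕ v with toℕ v <? n
    ... | yes v<n = cong cls (fromℕ<-toℕ v v<n)
    ... | no  v≮n = contradiction (toℕ<n v) v≮n

    seen : ℕ → List (Fin k)
    seen zero    = []
    seen (suc t) with classAt t ∈? seen t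
    ... | yes _ = seen t
    ... | no  _ = seen t ++ (classAt t ∷ [])

    seen-step : ∀ t → ∃ λ r → seen (suc t) ≡ seen t ++ r
    seen-step t with classAt t ∈? seen t
    ... | yes _ = [] , sym (++-identityʳ (seen t))
    ... | no  _ = (classAt t ∷ []) , refl

    seen-prefix : ∀ t d → ∃ λ r → seen (t + d) ≡ seen t ++ r
    seen-prefix t zero rewrite +-identityʳ t = [] , sym (++-identityʳ (seen t))
    seen-prefix t (suc d) with seen-prefix t d | seen-step (t + d)
    ... | r , eq | r′ , eq′ = r ++ r′ , (begin
      seen (t + suc d)       ≡⟨ cong seen (+-suc t d) ⟩
      seen (suc (t + d))     ≡⟨ eq′ ⟩
      seen (t + d) ++ r′     ≡⟨ cong (_++ r′) eq ⟩
      (seen t ++ r) ++ r′    ≡⟨ ++-assoc (seen t) r r′ ⟩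
      seen t ++ (r ++ r′)    ∎)
      where open ≡-Reasoning

    classAt∈seen : ∀ t → classAt t ∈ seen (suc t)
    classAt∈seen t with classAt t ∈? seen t
    ... | yes x∈ = x∈
    ... | no  _  = ∈-++⁺ʳ (seen t) (here refl)

    S : List (Fin k)
    S = seen n

    S-extends : ∀ {t} → t < n → ∃ λ r → S ≡ seen (suc t) ++ r
    S-extends {t} t<n with m≤n⇒∃[o]m+o≡n t<n
    ... | d , t+d≡n with seen-prefix (suc t) d
    ...   | r , eq = r , trans (cong seen (sym t+d≡n)) eq

    every-class∈S : ∀ i → i ∈ S
    every-class∈S i with surj i
    ... | v , refl with S-extends (toℕ<n v)
    ...   | r , S≡ = subst (_∈_ (cls v)) (sym S≡)
                         (∈-++⁺ˡ (subst (_∈ seen (suc (toℕ v))) (classAt-toℕ v) (classAt∈seen (toℕ v))))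

    rank : Fin k → ℕ
    rank = indexIn S

    lab : ℕ → ℕ
    lab t = rank (classAt t)

    labelling : Labelling cls lab
    labelling = record
      { rank = rank
      ; rank-injective = indexIn-injective S (every-class∈S _) (every-class∈S _)
      ; lab≡rank = λ v → cong rank (classAt-toℕ v)
      }

    lab-local : ∀ {t} → t < n → lab t ≡ indexIn (seen (suc t)) (classAt t)
    lab-local {t} t<n with S-extends t<n
    ... | r , S≡ = trans (cong (λ xs → indexIn xs (classAt t)) S≡) (indexIn-++ (seen (suc t)) r (classAt∈seen t))

    growth : ∀ t → t ≤ n → labelCount (build t lab) ≡ length (seen t) × RestrictedGrowth (build t lab)
    growth zero    _   = refl , tt
    growth (suc t) t<n with growth t (<⇒≤ t<n) | lab-local t<n
    ... | count≡ , rg | lab≡ with classAt t ∈? seen t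
    ...   | yes x∈ = trans (cong (nextCount (lab t)) count≡) (old (lab t) (length (seen t)) lab<)
                   , ≤-trans (<⇒≤ lab<) (≤-reflexive (sym count≡)) , rg
      where
        lab< : lab t < length (seen t)
        lab< = subst (_< length (seen t)) (sym lab≡) (indexIn-< (seen t) x∈)
        old : ∀ x K → x < K → nextCount x K ≡ K
        old x K x<K with x ≡ᵇ K in x≡K
        ... | false = refl
        ... | true  = contradiction (≡ᵇ⇒≡ x K (subst T (sym x≡K) tt)) (<⇒≢ x<K)
    ...   | no x∉ = trans (cong₂ nextCount lab≡K count≡)
                        (trans (new (length (seen t))) (sym (trans (length-++ (seen t)) (+-comm (length (seen t)) 1))))
                  , ≤-reflexive (trans lab≡K (sym count≡)) , rg
      where
        lab≡K : lab t ≡ length (seen t)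
        lab≡K = trans lab≡ (indexIn-new (seen t) x∉)
        new : ∀ K → nextCount K K ≡ suc K
        new K with K ≡ᵇ K | ≡⇒≡ᵇ K K refl
        ... | true | _ = refl

    canonicalWord : List ℕ
    canonicalWord = build n lab

    restrictedGrowth : RestrictedGrowth canonicalWord
    restrictedGrowth = proj₂ (growth n ≤-refl)

    private
      word = canonicalWord
      count≡ = proj₁ (growth n ≤-refl)

    rank<labelCount : ∀ i → rank i < labelCount word
    rank<labelCount i = subst (rank i <_) (sym count≡) (indexIn-< S (every-class∈S i))

    label⇒rank : ∀ {j} → j < labelCount word → ∃ λ t → t < n × rank (classAt t) ≡ j
    label⇒rank j< = ∈-build n lab (RestrictedGrowth-onto word restrictedGrowth j<)

    labelCount≡k : labelCount word ≡ k
    labelCount≡k = ≤-antisym (injective⇒≤ {f = class} class-injective) (injective⇒≤ {f = label} label-injective)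
      where
        class : Fin (labelCount word) → Fin k
        class j = classAt (proj₁ (label⇒rank (toℕ<n j)))
        class-injective : ∀ {j j′} → class j ≡ class j′ → j ≡ j′
        class-injective {j} {j′} eq = toℕ-injective (trans (sym (proj₂ (proj₂ (label⇒rank (toℕ<n j)))))
                                        (trans (cong rank eq) (proj₂ (proj₂ (label⇒rank (toℕ<n j′))))))
        label : Fin k → Fin (labelCount word)
        label i = fromℕ< (rank<labelCount i)
        label-injective : ∀ {i i′} → label i ≡ label i′ → i ≡ i′
        label-injective {i} {i′} eq = Labelling.rank-injective labelling
          (trans (sym (toℕ-fromℕ< (rank<labelCount i))) (trans (cong toℕ eq) (toℕ-fromℕ< (rank<labelCount i′))))

    rank<k : ∀ i → rank i < k
    rank<k i = subst (rank i <_) labelCount≡k (rank<labelCount i)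

    rank-onto : ∀ {j} → j < k → ∃ λ i → rank i ≡ j
    rank-onto j<k with label⇒rank (subst (_ <_) (sym labelCount≡k) j<k)
    ... | t , _ , eq = classAt t , eq

singletonDominating-near : ∀ {n} {A : VSet (P n)} (sing : IsSingleton (P n) A) → Dominating (P n) A →
                           ∀ t → t < n → let v = proj₁ sing in t ≡ toℕ v ⊎ suc t ≡ toℕ v ⊎ suc (toℕ v) ≡ t
singletonDominating-near (v , _ , only) dom t t<n with fromℕ< t<n ≟ᶠ v
... | yes x≡v = inj₁ (trans (sym (toℕ-fromℕ< t<n)) (cong toℕ x≡v))
... | no  x≢v with dom (fromℕ< t<n) (x≢v ∘ only _)
...   | u , Au , adj with only u Au
...     | refl = inj₂ (map (subst (λ x → suc x ≡ toℕ u) (toℕ-fromℕ< t<n))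
                           (subst (suc (toℕ u) ≡_) (toℕ-fromℕ< t<n)) adj)

noSingletonDominating : ∀ {n} → 4 ≤ n → (A : VSet (P n)) → IsSingleton (P n) A → ¬ Dominating (P n) A
noSingletonDominating 4≤n A sing dom =
  apart (singletonDominating-near sing dom 0 (≤-trans (s≤s z≤n) 4≤n)) (singletonDominating-near sing dom 3 4≤n)
  where
    apart : ∀ {p} → 0 ≡ p ⊎ 1 ≡ p ⊎ suc p ≡ 0 → 3 ≡ p ⊎ 4 ≡ p ⊎ suc p ≡ 3 → ⊥
    apart (inj₁ refl)        (inj₁ ())
    apart (inj₁ refl)        (inj₂ (inj₁ ()))
    apart (inj₁ refl)        (inj₂ (inj₂ ()))
    apart (inj₂ (inj₁ refl)) (inj₁ ())
    apart (inj₂ (inj₁ refl)) (inj₂ (inj₁ ()))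
    apart (inj₂ (inj₁ refl)) (inj₂ (inj₂ ()))
    apart (inj₂ (inj₂ ()))   _

prefixPaired : ℕ → List ℕ → Bool
prefixPaired k w = paired k (localCoalition (belowHead w))

noPruning : List ℕ → Bool
noPruning _ = true

paired⇒prefixPaired : ∀ k q x s → T (paired k (coalition (onWord (q ʳ++ x ∷ s)))) → T (prefixPaired k (x ∷ s))
paired⇒prefixPaired k q x s = paired-mono {k} λ j j′ →
  localCoalition-mono {onWord (q ʳ++ x ∷ s)} {belowHead (x ∷ s)} (onWord-ʳ++⇒belowHead q x s) j j′
  ∘ coalition⇒localCoalition (onWord (q ʳ++ x ∷ s)) j j′

module FromPartition {n k : ℕ} (π : Partition (P (suc n)) k) (prc : IsPRCPartition (P (suc n)) π) where
  open Partition π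
  open CanonicalLabelling π (cls fzero) public
  open Labelling labelling using (rank-injective)

  private
    word = canonicalWord

    word≡path : ∀ j j′ → coalition (onWord word) j j′ ≡ coalition (onPath (suc n) lab) j j′
    word≡path = coalition-cong (holdsOnWord-build (suc n) lab)

    partner : ∀ i i′ → i ≢ i′ → PerfectCoalition (P (suc n)) (Class i) (Class i′) →
              T (hasPartner k (coalition (onPath (suc n) lab)) (rank i))
    partner i i′ i≢i′ pc = anyBelow⁺ k _ (rank i′) (rank<k i′)
      (∧-intro (not-intro _ (i≢i′ ∘ rank-injective ∘ ≡ᵇ⇒≡ _ _)) (coalition⁺ labelling i i′ pc))

    classCondition : ∀ i → T (singletonDominating word (rank i) ∨ hasPartner k (coalition (onWord word)) (rank i))
    classCondition i with prc i
    ... | inj₁ (sing , dom) = ∨-introˡ _ (∧-intro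
          (≡⇒≡ᵇ _ _ (trans (occurrences-build (isLabel (rank i)) (suc n) lab) (singleton⁺ labelling i sing)))
          (subst T (sym (holdsOnWord-build (suc n) lab dominatedW (isLabel (rank i)))) (to (dominating⇔ (class-χ labelling i)) dom)))
    ... | inj₂ (i′ , i≢i′ , pc) = ∨-introʳ (singletonDominating word (rank i))
          (hasPartner-mono {k} (λ j j′ → subst T (sym (word≡path j j′))) (rank i) (partner i i′ i≢i′ pc))

  prcWord-holds : T (prcWord k word)
  prcWord-holds = allBelow⁺ k _ λ j j<k → let i , rank≡ = rank-onto j<k in
    subst (λ j → T (singletonDominating word j ∨ hasPartner k (coalition (onWord word)) j)) rank≡ (classCondition i)

  paired-holds : 4 ≤ suc n → T (paired k (coalition (onPath (suc n) lab)))
  paired-holds 4≤n = allBelow⁺ k _ λ j j<k → let i , rank≡ = rank-onto j<k in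
    subst (T ∘ hasPartner k (coalition (onPath (suc n) lab))) rank≡ (classPartner i)
    where
      classPartner : ∀ i → T (hasPartner k (coalition (onPath (suc n) lab)) (rank i))
      classPartner i with prc i
      ... | inj₁ (sing , dom)     = contradiction dom (noSingletonDominating 4≤n (Class i) sing)
      ... | inj₂ (i′ , i≢i′ , pc) = partner i i′ i≢i′ pc

  search-succeeds : ∀ prune → (∀ q x s → word ≡ q ʳ++ x ∷ s → T (prune (x ∷ s))) →
                    T (search prune (prcWord k) k (suc n) [])
  search-succeeds prune pruned = subst (λ t → T (search prune (prcWord k) k t [])) (length-build (suc n) lab)
    (search-complete prune (prcWord k) k word restrictedGrowth labelCount≡k prcWord-holds pruned)

  pruned-search-succeeds : 4 ≤ suc n → T (search (prefixPaired k) (prcWord k) k (suc n) [])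
  pruned-search-succeeds 4≤n = search-succeeds (prefixPaired k) λ q x s word≡ →
    paired⇒prefixPaired k q x s (subst (λ w → T (paired k (coalition (onWord w)))) word≡
      (paired-mono {k} (λ j j′ → subst T (sym (word≡path j j′))) (paired-holds 4≤n)))

-- At most six classes

module PathLabelling (n : ℕ) (g : ℕ → ℕ) where

  InPair : ℕ → ℕ → ℕ → Set
  InPair j h x = x ≡ j ⊎ x ≡ h

  record Partners (j h : ℕ) : Set where
    field
      covered : ∀ {t} → t < n → ¬ InPair j h (g t) →
                (suc t < n × InPair j h (g (suc t))) ⊎ (∃ λ t′ → t ≡ suc t′ × InPair j h (g t′))
      notBoth : ∀ {t} → suc (suc t) < n → ¬ InPair j h (g (suc t)) → InPair j h (g t) → ¬ InPair j h (g (suc (suc t)))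

  Undominated : ℕ → ℕ → Set
  Undominated h y = y < n × g y ≢ h × (suc y < n → g (suc y) ≢ h) × (∀ {y′} → y ≡ suc y′ → g y′ ≢ h)

  private
    inPair⇒ : ∀ j h x → T (inPair j h x) → InPair j h x
    inPair⇒ j h x p with ∨-elim (x ≡ᵇ j) p
    ... | inj₁ e = inj₁ (≡ᵇ⇒≡ x j e)
    ... | inj₂ e = inj₂ (≡ᵇ⇒≡ x h e)

    ⇒inPair : ∀ j h x → InPair j h x → T (inPair j h x)
    ⇒inPair j h x (inj₁ e) = ∨-introˡ _ (≡⇒≡ᵇ x j e)
    ⇒inPair j h x (inj₂ e) = ∨-introʳ (x ≡ᵇ j) (≡⇒≡ᵇ x h e)

    selected⇒ : ∀ m {t} → T (select n g m t) → t < n × T (m (g t))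
    selected⇒ m {t} p with ∧-elim (t <ᵇ n) p
    ... | t<n , mt = <ᵇ⇒< t n t<n , mt

    ⇒selected : ∀ m {t} → t < n → T (m (g t)) → T (select n g m t)
    ⇒selected m t<n mt = ∧-intro (<⇒<ᵇ t<n) mt

  coalition⇒partners : ∀ {j h} → T (coalition (onPath n g) j h) → Partners j h
  coalition⇒partners {j} {h} c with to (coalition⇔ (onPath n g) j h) c
  ... | dom , amo , _ = record { covered = covered ; notBoth = notBoth }
    where
      s = select n g (inPair j h)
      out : ∀ {t} → ¬ InPair j h (g t) → ¬ T (s t)
      out ∉ = ∉ ∘ inPair⇒ j h _ ∘ proj₂ ∘ selected⇒ (inPair j h)
      covered : ∀ {t} → t < n → ¬ InPair j h (g t) →
                (suc t < n × InPair j h (g (suc t))) ⊎ (∃ λ t′ → t ≡ suc t′ × InPair j h (g t′))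
      covered {t} t<n ∉ with ∨-elim (s t) (allBelow⁻ n _ dom t t<n)
      ... | inj₁ st = contradiction st (out ∉)
      ... | inj₂ lr with ∨-elim (leftOf s t) lr
      ...   | inj₂ r = let t+1<n , p = selected⇒ (inPair j h) r in inj₁ (t+1<n , inPair⇒ j h _ p)
      ...   | inj₁ l = inj₂ (left t l)
        where
          left : ∀ t → T (leftOf s t) → ∃ λ t′ → t ≡ suc t′ × InPair j h (g t′)
          left (suc t′) l = t′ , refl , inPair⇒ j h _ (proj₂ (selected⇒ (inPair j h) l))
      notBoth : ∀ {t} → suc (suc t) < n → ¬ InPair j h (g (suc t)) → InPair j h (g t) → ¬ InPair j h (g (suc (suc t)))
      notBoth {t} t+2<n ∉ before after with ∨-elim (s (suc t)) (allBelow⁻ n _ amo (suc t) (≤-trans (n≤1+n _) t+2<n))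
      ... | inj₁ st    = out ∉ st
      ... | inj₂ ¬both = not-elim _ ¬both (∧-intro
            (⇒selected (inPair j h) (≤-trans (n≤1+n _) (≤-trans (n≤1+n _) t+2<n)) (⇒inPair j h _ before))
            (⇒selected (inPair j h) t+2<n (⇒inPair j h _ after)))

  coalition⇒undominated : ∀ {j h} → T (coalition (onPath n g) j h) → ∃ (Undominated h)
  coalition⇒undominated {j} {h} c with to (coalition⇔ (onPath n g) j h) c
  ... | _ , _ , _ , _ , _ , ¬dom with ¬allBelow⁻ n _ ¬dom
  ...   | y , y<n , ¬window = y , y<n , notAt , notRight , notLeft
    where
      s = select n g (isLabel h)
      in-s : ∀ {t} → t < n → g t ≡ h → T (s t)
      in-s t<n e = ⇒selected (isLabel h) t<n (≡⇒≡ᵇ _ h e)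
      notAt : g y ≢ h
      notAt e = ¬window (∨-introˡ _ (in-s y<n e))
      notRight : suc y < n → g (suc y) ≢ h
      notRight y+1<n e = ¬window (∨-introʳ (s y) (∨-introʳ (leftOf s y) (in-s y+1<n e)))
      notLeft : ∀ {y′} → y ≡ suc y′ → g y′ ≢ h
      notLeft refl e = ¬window (∨-introʳ (s y) (∨-introˡ _ (in-s (≤-trans (n≤1+n _) y<n) e)))

  record Triangle (h a b l : ℕ) : Set where
    field
      partnerᵃ : Partners a h
      partnerᵇ : Partners b h
      partnerˡ : Partners l h
      a≢b : a ≢ b
      b≢l : b ≢ l
      l≢a : l ≢ a
      a≢h : a ≢ h
      b≢h : b ≢ h
      l≢h : l ≢ h

  rotate : ∀ {h a b l} → Triangle h a b l → Triangle h b l a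
  rotate t = record { partnerᵃ = partnerᵇ ; partnerᵇ = partnerˡ ; partnerˡ = partnerᵃ
                    ; a≢b = b≢l ; b≢l = l≢a ; l≢a = a≢b ; a≢h = b≢h ; b≢h = l≢h ; l≢h = a≢h }
    where open Triangle t

  swap : ∀ {h a b l} → Triangle h a b l → Triangle h b a l
  swap t = record { partnerᵃ = partnerᵇ ; partnerᵇ = partnerᵃ ; partnerˡ = partnerˡ
                  ; a≢b = a≢b ∘ sym ; b≢l = l≢a ∘ sym ; l≢a = b≢l ∘ sym
                  ; a≢h = b≢h ; b≢h = a≢h ; l≢h = l≢h }
    where open Triangle t

  nextIsThird : ∀ {h a b l t} → Triangle h a b l → suc t < n → g t ≡ a → g (suc t) ≡ b →
                suc (suc t) < n × g (suc (suc t)) ≡ l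
  nextIsThird {h} {a} {b} {l} {t} tri t+1<n gt≡a gt+1≡b with Partners.covered partnerˡ t+1<n b∉lh
    where
      open Triangle tri
      b∉lh : ¬ InPair l h (g (suc t))
      b∉lh = [ b≢l ∘ trans (sym gt+1≡b) , b≢h ∘ trans (sym gt+1≡b) ]
  ... | inj₁ (t+2<n , inj₁ gt+2≡l) = t+2<n , gt+2≡l
  ... | inj₁ (t+2<n , inj₂ gt+2≡h) = contradiction (inj₂ gt+2≡h) (Partners.notBoth partnerᵃ t+2<n b∉ah (inj₁ gt≡a))
    where
      open Triangle tri
      b∉ah : ¬ InPair a h (g (suc t))
      b∉ah = [ a≢b ∘ sym ∘ trans (sym gt+1≡b) , b≢h ∘ trans (sym gt+1≡b) ]
  ... | inj₂ (_ , refl , a∈lh) = ⊥-elim ([ l≢a ∘ sym , a≢h ] (subst (InPair l h) gt≡a a∈lh))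
    where open Triangle tri

  -- By nextIsThird the labels a b l a b l … would never end; d counts the vertices after t + 1.
  propagate : ∀ d {h a b l t} → Triangle h a b l → suc (suc t) + d ≡ n → g t ≡ a → g (suc t) ≡ b → ⊥
  propagate d {t = t} tri len gt≡a gt+1≡b
    with nextIsThird tri (subst (suc t <_) len (m≤m+n (suc (suc t)) d)) gt≡a gt+1≡b
  propagate zero    tri len gt≡a gt+1≡b | t+2<n , _ = <-irrefl (trans (sym (+-identityʳ _)) len) t+2<n
  propagate (suc d) tri len gt≡a gt+1≡b | _ , gt+2≡l = propagate d (rotate tri) (trans (sym (+-suc _ d)) len) gt+1≡b gt+2≡l

  startAt : ∀ {h a b l y} → Triangle h a b l → suc y < n → g y ≡ a → g (suc y) ≡ b → ⊥
  startAt tri y+1<n gy≡a gy+1≡b with m≤n⇒∃[o]m+o≡n y+1<n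
  ... | d , len = propagate d tri len gy≡a gy+1≡b

  data Near (y j : ℕ) : Set where
    at    : g y ≡ j → Near y j
    right : suc y < n → g (suc y) ≡ j → Near y j
    left  : ∀ {y′} → y ≡ suc y′ → g y′ ≡ j → Near y j

  near : ∀ {h j y} → Partners j h → Undominated h y → Near y j
  near {h} {j} {y} p (y<n , gy≢h , right≢h , left≢h) with g y ≟ j
  ... | yes gy≡j = at gy≡j
  ... | no  gy≢j with Partners.covered p y<n [ gy≢j , gy≢h ]
  ...   | inj₁ (y+1<n , inj₁ e) = right y+1<n e
  ...   | inj₁ (y+1<n , inj₂ e) = contradiction e (right≢h y+1<n)
  ...   | inj₂ (_ , y≡ , inj₁ e) = left y≡ e
  ...   | inj₂ (_ , y≡ , inj₂ e) = contradiction e (left≢h y≡)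

  private
    sameLeft : ∀ {y y′ y″ x x′} → y ≡ suc y′ → g y′ ≡ x → y ≡ suc y″ → g y″ ≡ x′ → x ≡ x′
    sameLeft refl gy′≡x refl gy″≡x′ = trans (sym gy′≡x) gy″≡x′

  -- Distinct labels sit at distinct vertices, so two of the partners label y and y + 1.
  noTriangle : ∀ {h a b l y} → Triangle h a b l → Near y a → Near y b → Near y l → ⊥
  noTriangle tri (at ea)      (right r eb) _            = startAt tri r ea eb
  noTriangle tri (right r ea) (at eb)      _            = startAt (swap tri) r eb ea
  noTriangle tri (at ea)      _            (right r el) = startAt (swap (rotate (rotate tri))) r ea el
  noTriangle tri (right r ea) _            (at el)      = startAt (rotate (rotate tri)) r el ea
  noTriangle tri _            (at eb)      (right r el) = startAt (rotate tri) r eb el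
  noTriangle tri _            (right r eb) (at el)      = startAt (swap (rotate tri)) r el eb
  noTriangle tri (at ea)      (at eb)      _            = Triangle.a≢b tri (trans (sym ea) eb)
  noTriangle tri (right _ ea) (right _ eb) _            = Triangle.a≢b tri (trans (sym ea) eb)
  noTriangle tri (left p ea)  (left q eb)  _            = Triangle.a≢b tri (sameLeft p ea q eb)
  noTriangle tri (at ea)      (left _ _)   (at el)      = Triangle.l≢a tri (trans (sym el) ea)
  noTriangle tri (right _ ea) (left _ _)   (right _ el) = Triangle.l≢a tri (trans (sym el) ea)
  noTriangle tri (left p ea)  _            (left q el)  = Triangle.l≢a tri (sameLeft q el p ea)
  noTriangle tri _            (at eb)      (at el)      = Triangle.b≢l tri (trans (sym eb) el)
  noTriangle tri _            (right _ eb) (right _ el) = Triangle.b≢l tri (trans (sym eb) el)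
  noTriangle tri _            (left p eb)  (left q el)  = Triangle.b≢l tri (sameLeft p eb q el)

module _ {m k : ℕ} {g : ℕ → ℕ} (pairedUp : T (paired k (coalition (onPath (suc (suc m)) g)))) where
  private
    n = suc (suc m)
  open PathLabelling n g

  private
    a b d e : ℕ
    a = g 0
    b = g 1
    d = g m
    e = g (suc m)

    isEnd : ℕ → Bool
    isEnd j = (j ≡ᵇ a) ∨ ((j ≡ᵇ b) ∨ ((j ≡ᵇ d) ∨ (j ≡ᵇ e)))

    innerPartner : ℕ → ℕ → Bool
    innerPartner x j = not (isEnd j) ∧ coalition (onPath n g) j x

    AtRight : ℕ → Set
    AtRight x = x ≡ d ⊎ x ≡ e

    end⁺ : ∀ {j} → j ≡ a ⊎ j ≡ b ⊎ j ≡ d ⊎ j ≡ e → T (isEnd j)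
    end⁺ {j} (inj₁ j≡a)               = ∨-introˡ _ (≡⇒≡ᵇ j a j≡a)
    end⁺ {j} (inj₂ (inj₁ j≡b))        = ∨-introʳ (j ≡ᵇ a) (∨-introˡ _ (≡⇒≡ᵇ j b j≡b))
    end⁺ {j} (inj₂ (inj₂ (inj₁ j≡d))) = ∨-introʳ (j ≡ᵇ a) (∨-introʳ (j ≡ᵇ b) (∨-introˡ _ (≡⇒≡ᵇ j d j≡d)))
    end⁺ {j} (inj₂ (inj₂ (inj₂ j≡e))) = ∨-introʳ (j ≡ᵇ a) (∨-introʳ (j ≡ᵇ b) (∨-introʳ (j ≡ᵇ d) (≡⇒≡ᵇ j e j≡e)))

    end⁻ : ∀ {j} → T (isEnd j) → j ≡ a ⊎ j ≡ b ⊎ j ≡ d ⊎ j ≡ e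
    end⁻ {j} p with ∨-elim (j ≡ᵇ a) p
    ... | inj₁ q = inj₁ (≡ᵇ⇒≡ j a q)
    ... | inj₂ p with ∨-elim (j ≡ᵇ b) p
    ...   | inj₁ q = inj₂ (inj₁ (≡ᵇ⇒≡ j b q))
    ...   | inj₂ p with ∨-elim (j ≡ᵇ d) p
    ...     | inj₁ q = inj₂ (inj₂ (inj₁ (≡ᵇ⇒≡ j d q)))
    ...     | inj₂ q = inj₂ (inj₂ (inj₂ (≡ᵇ⇒≡ j e q)))

    leftEnd : ∀ {j j′} → Partners j j′ → InPair j j′ a ⊎ InPair j j′ b
    leftEnd {j} {j′} p with a ≟ j | a ≟ j′
    ... | yes a≡j | _        = inj₁ (inj₁ a≡j)
    ... | no  _   | yes a≡j′ = inj₁ (inj₂ a≡j′)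
    ... | no  a≢j | no  a≢j′ with Partners.covered p (s≤s z≤n) [ a≢j , a≢j′ ]
    ...   | inj₁ (_ , b∈) = inj₂ b∈

    rightEnd : ∀ {j j′} → Partners j j′ → InPair j j′ e ⊎ InPair j j′ d
    rightEnd {j} {j′} p with e ≟ j | e ≟ j′
    ... | yes e≡j | _        = inj₁ (inj₁ e≡j)
    ... | no  _   | yes e≡j′ = inj₁ (inj₂ e≡j′)
    ... | no  e≢j | no  e≢j′ with Partners.covered p ≤-refl [ e≢j , e≢j′ ]
    ...   | inj₁ (n<n , _)          = contradiction n<n (<-irrefl refl)
    ...   | inj₂ (_ , refl , d∈)    = inj₂ d∈

    innerPartner⇒ : ∀ x j → T (innerPartner x j) → ¬ T (isEnd j) × T (coalition (onPath n g) j x)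
    innerPartner⇒ x j p with ∧-elim (not (isEnd j)) p
    ... | ¬end , c = not-elim _ ¬end , c

    innerPartner⇒AtRight : ∀ x j → T (innerPartner x j) → AtRight x
    innerPartner⇒AtRight x j p with innerPartner⇒ x j p
    ... | ¬end , c with rightEnd (coalition⇒partners c)
    ...   | inj₁ (inj₁ e≡j) = ⊥-elim (¬end (end⁺ (inj₂ (inj₂ (inj₂ (sym e≡j))))))
    ...   | inj₁ (inj₂ e≡x) = inj₂ (sym e≡x)
    ...   | inj₂ (inj₁ d≡j) = ⊥-elim (¬end (end⁺ (inj₂ (inj₂ (inj₁ (sym d≡j))))))
    ...   | inj₂ (inj₂ d≡x) = inj₁ (sym d≡x)

    innerPartner≢ : ∀ x j → T (innerPartner x j) → j ≢ x
    innerPartner≢ x .x p refl with innerPartner⇒ x x p | innerPartner⇒AtRight x x p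
    ... | ¬end , _ | inj₁ x≡d = ¬end (end⁺ (inj₂ (inj₂ (inj₁ x≡d))))
    ... | ¬end , _ | inj₂ x≡e = ¬end (end⁺ (inj₂ (inj₂ (inj₂ x≡e))))

    classified : ∀ j → j < k → T (isEnd j ∨ (innerPartner a j ∨ innerPartner b j))
    classified j j<k with T? (isEnd j)
    ... | yes end = ∨-introˡ _ end
    ... | no ¬end with anyBelow⁻ k _ (allBelow⁻ k _ pairedUp j j<k)
    ...   | j′ , _ , p with ∧-elim (not (j ≡ᵇ j′)) p
    ...     | _ , c with leftEnd (coalition⇒partners c)
    ...       | inj₁ (inj₁ a≡j)  = contradiction (end⁺ (inj₁ (sym a≡j))) ¬end
    ...       | inj₂ (inj₁ b≡j)  = contradiction (end⁺ (inj₂ (inj₁ (sym b≡j)))) ¬end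
    ...       | inj₁ (inj₂ refl) = ∨-introʳ (isEnd j) (∨-introˡ _ (∧-intro (not-intro _ ¬end) c))
    ...       | inj₂ (inj₂ refl) = ∨-introʳ (isEnd j) (∨-introʳ (innerPartner a j) (∧-intro (not-intro _ ¬end) c))

    atMostOneLabel : ∀ x → countBelow k (_≡ᵇ x) ≤ 1
    atMostOneLabel x = countBelow≤1 k λ j j′ j′<j _ p p′ →
      <⇒≢ j′<j (trans (≡ᵇ⇒≡ j′ x p′) (sym (≡ᵇ⇒≡ j x p)))

    atMostTwoInnerPartners : ∀ x → countBelow k (innerPartner x) ≤ 2
    atMostTwoInnerPartners x = countBelow≤2 k λ j j′ j″ j″<j′ j′<j _ p p′ p″ →
      let c = proj₂ (innerPartner⇒ x j p)
          y , undominated = coalition⇒undominated c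
          tri = record
            { partnerᵃ = coalition⇒partners c
            ; partnerᵇ = coalition⇒partners (proj₂ (innerPartner⇒ x j′ p′))
            ; partnerˡ = coalition⇒partners (proj₂ (innerPartner⇒ x j″ p″))
            ; a≢b = <⇒≢ j′<j ∘ sym ; b≢l = <⇒≢ j″<j′ ∘ sym ; l≢a = <⇒≢ (<-trans j″<j′ j′<j)
            ; a≢h = innerPartner≢ x j p ; b≢h = innerPartner≢ x j′ p′ ; l≢h = innerPartner≢ x j″ p″ }
          open Triangle tri
      in noTriangle tri (near partnerᵃ undominated) (near partnerᵇ undominated) (near partnerˡ undominated)

    noInnerPartners : ∀ x → ¬ AtRight x → countBelow k (innerPartner x) ≤ 0
    noInnerPartners x ¬right = ≤-reflexive (countBelow-none k λ j _ p → ¬right (innerPartner⇒AtRight x j p))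

    atMostFourEnds : countBelow k isEnd ≤ 4
    atMostFourEnds =
      ≤-trans (countBelow-∨ k _ _) (+-mono-≤ (atMostOneLabel a)
      (≤-trans (countBelow-∨ k _ _) (+-mono-≤ (atMostOneLabel b)
      (≤-trans (countBelow-∨ k _ _) (+-mono-≤ (atMostOneLabel d) (atMostOneLabel e))))))

    atMostTwoEnds : AtRight a → AtRight b → countBelow k isEnd ≤ 2
    atMostTwoEnds a-right b-right =
      ≤-trans (countBelow-mono k λ j _ → rightLabel {j} ∘ end⁻ {j})
              (≤-trans (countBelow-∨ k _ _) (+-mono-≤ (atMostOneLabel d) (atMostOneLabel e)))
      where
        toRight : ∀ {j x} → j ≡ x → AtRight x → T ((j ≡ᵇ d) ∨ (j ≡ᵇ e))
        toRight {j} refl (inj₁ x≡d) = ∨-introˡ _ (≡⇒≡ᵇ j d x≡d)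
        toRight {j} refl (inj₂ x≡e) = ∨-introʳ (j ≡ᵇ d) (≡⇒≡ᵇ j e x≡e)
        rightLabel : ∀ {j} → j ≡ a ⊎ j ≡ b ⊎ j ≡ d ⊎ j ≡ e → T ((j ≡ᵇ d) ∨ (j ≡ᵇ e))
        rightLabel (inj₁ j≡a)               = toRight j≡a a-right
        rightLabel (inj₂ (inj₁ j≡b))        = toRight j≡b b-right
        rightLabel (inj₂ (inj₂ (inj₁ j≡d))) = toRight j≡d (inj₁ refl)
        rightLabel (inj₂ (inj₂ (inj₂ j≡e))) = toRight j≡e (inj₂ refl)

    k≤ends+inner : k ≤ countBelow k isEnd + (countBelow k (innerPartner a) + countBelow k (innerPartner b))
    k≤ends+inner =
      ≤-trans (countBelow-all k classified)
      (≤-trans (countBelow-∨ k isEnd _) (+-monoʳ-≤ (countBelow k isEnd) (countBelow-∨ k (innerPartner a) (innerPartner b))))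

    atRight? : ∀ x → AtRight x ⊎ ¬ AtRight x
    atRight? x with x ≟ d | x ≟ e
    ... | yes x≡d | _       = inj₁ (inj₁ x≡d)
    ... | no  _   | yes x≡e = inj₁ (inj₂ x≡e)
    ... | no  x≢d | no  x≢e = inj₂ [ x≢d , x≢e ]

  pairedLabelling≤6 : k ≤ 6
  pairedLabelling≤6 with atRight? a | atRight? b
  ... | inj₂ ¬a-right | _ =
    ≤-trans k≤ends+inner (+-mono-≤ atMostFourEnds (+-mono-≤ (noInnerPartners a ¬a-right) (atMostTwoInnerPartners b)))
  ... | inj₁ _ | inj₂ ¬b-right =
    ≤-trans k≤ends+inner (+-mono-≤ atMostFourEnds (+-mono-≤ (atMostTwoInnerPartners a) (noInnerPartners b ¬b-right)))
  ... | inj₁ a-right | inj₁ b-right =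
    ≤-trans k≤ends+inner
      (+-mono-≤ (atMostTwoEnds a-right b-right) (+-mono-≤ (atMostTwoInnerPartners a) (atMostTwoInnerPartners b)))

-- Constructions

module _ {n k : ℕ} {g : ℕ → ℕ} (g<k : ∀ t → t < n → g t < k)
         (onto : ∀ j → j < k → ∃ λ t → t < n × g t ≡ j) where

  private
    cls : Fin n → Fin k
    cls v = fromℕ< (g<k (toℕ v) (toℕ<n v))

    labelling : Labelling cls g
    labelling = record
      { rank = toℕ
      ; rank-injective = toℕ-injective
      ; lab≡rank = λ v → sym (toℕ-fromℕ< (g<k (toℕ v) (toℕ<n v)))
      }

    π : Partition (P n) k
    π = record { cls = cls ; surj = surj }
      where
        surj : ∀ i → ∃ λ v → cls v ≡ i
        surj i with onto (toℕ i) (toℕ<n i)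
        ... | t , t<n , gt≡i = fromℕ< t<n , toℕ-injective
          (trans (toℕ-fromℕ< _) (trans (cong g (toℕ-fromℕ< t<n)) gt≡i))

  pairedLabelling⇒partition : T (paired k (coalition (onPath n g))) → HasPRCPartition (P n) k
  pairedLabelling⇒partition pairedUp = π , λ i → inj₂ (partnerOf i)
    where
      partnerOf : ∀ i → ∃ λ i′ → i ≢ i′ × PerfectCoalition (P n) (Partition.Class π i) (Partition.Class π i′)
      partnerOf i with anyBelow⁻ k _ (allBelow⁻ k _ pairedUp (toℕ i) (toℕ<n i))
      ... | j′ , j′<k , p with ∧-elim (not (toℕ i ≡ᵇ j′)) p
      ...   | i≢ᵇj′ , c = i′ , i≢i′ , coalition⁻ labelling i i′ i≢i′
                                     (subst (T ∘ coalition (onPath n g) (toℕ i)) (sym (toℕ-fromℕ< j′<k)) c)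
        where
          i′ = fromℕ< j′<k
          i≢i′ : i ≢ i′
          i≢i′ i≡i′ = not-elim _ i≢ᵇj′ (≡⇒≡ᵇ _ _ (trans (cong toℕ i≡i′) (toℕ-fromℕ< j′<k)))

module _ (n k : ℕ) (g : ℕ → ℕ) where

  labelsBelow : Bool
  labelsBelow = allBelow n λ t → g t <ᵇ k

  labelsUsed : ℕ → Bool
  labelsUsed s = allBelow k λ j → anyBelow s λ t → g t ≡ᵇ j

  labelsBelow⇒ : T labelsBelow → ∀ t → t < n → g t < k
  labelsBelow⇒ bounded t t<n = <ᵇ⇒< (g t) k (allBelow⁻ n _ bounded t t<n)

  labelsUsed⇒ : ∀ {s} → s ≤ n → T (labelsUsed s) → ∀ j → j < k → ∃ λ t → t < n × g t ≡ j
  labelsUsed⇒ s≤n used j j<k with anyBelow⁻ _ _ (allBelow⁻ k _ used j j<k)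
  ... | t , t<s , gt≡j = t , ≤-trans t<s s≤n , ≡ᵇ⇒≡ (g t) j gt≡j

prcLabelling⇒partition : ∀ n k g → T (labelsBelow n k g) → T (labelsUsed n k g n) → T (paired k (coalition (onPath n g))) →
                         HasPRCPartition (P n) k
prcLabelling⇒partition n k g bounded used =
  pairedLabelling⇒partition (labelsBelow⇒ n k g bounded) (labelsUsed⇒ n k g ≤-refl used)

fromList : List ℕ → ℕ → ℕ
fromList []       t       = 0
fromList (x ∷ xs) zero    = x
fromList (x ∷ xs) (suc t) = fromList xs t

prcPartition-P4 : HasPRCPartition (P 4) 4
prcPartition-P4 = prcLabelling⇒partition 4 4 (fromList (0 ∷ 1 ∷ 2 ∷ 3 ∷ [])) tt tt tt

prcPartition-P5 : HasPRCPartition (P 5) 3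
prcPartition-P5 = prcLabelling⇒partition 5 3 (fromList (0 ∷ 0 ∷ 1 ∷ 1 ∷ 2 ∷ [])) tt tt tt

prcPartition-P6 : HasPRCPartition (P 6) 4
prcPartition-P6 = prcLabelling⇒partition 6 4 (fromList (0 ∷ 1 ∷ 1 ∷ 0 ∷ 2 ∷ 3 ∷ [])) tt tt tt

prcPartition-P7 : HasPRCPartition (P 7) 5
prcPartition-P7 = prcLabelling⇒partition 7 5 (fromList (0 ∷ 1 ∷ 2 ∷ 0 ∷ 3 ∷ 1 ∷ 4 ∷ [])) tt tt tt

prcPartition-P8 : HasPRCPartition (P 8) 4
prcPartition-P8 = prcLabelling⇒partition 8 4 (fromList (0 ∷ 1 ∷ 1 ∷ 0 ∷ 0 ∷ 1 ∷ 2 ∷ 3 ∷ [])) tt tt tt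

prcPartition-P9 : HasPRCPartition (P 9) 5
prcPartition-P9 = prcLabelling⇒partition 9 5 (fromList (0 ∷ 1 ∷ 1 ∷ 0 ∷ 2 ∷ 1 ∷ 3 ∷ 0 ∷ 4 ∷ [])) tt tt tt

prcPartition-P10 : HasPRCPartition (P 10) 5
prcPartition-P10 = prcLabelling⇒partition 10 5 (fromList (0 ∷ 1 ∷ 2 ∷ 0 ∷ 3 ∷ 2 ∷ 0 ∷ 3 ∷ 1 ∷ 4 ∷ [])) tt tt tt

prcPartition-P11 : HasPRCPartition (P 11) 5
prcPartition-P11 = prcLabelling⇒partition 11 5 (fromList (0 ∷ 1 ∷ 1 ∷ 0 ∷ 0 ∷ 1 ∷ 2 ∷ 0 ∷ 3 ∷ 1 ∷ 4 ∷ [])) tt tt tt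

prcPartition-P12 : HasPRCPartition (P 12) 6
prcPartition-P12 = prcLabelling⇒partition 12 6 (fromList (0 ∷ 1 ∷ 2 ∷ 0 ∷ 3 ∷ 1 ∷ 0 ∷ 4 ∷ 1 ∷ 5 ∷ 0 ∷ 1 ∷ [])) tt tt tt

prcPartition-P13 : HasPRCPartition (P 13) 5
prcPartition-P13 = prcLabelling⇒partition 13 5 (fromList (0 ∷ 1 ∷ 1 ∷ 0 ∷ 0 ∷ 1 ∷ 1 ∷ 0 ∷ 2 ∷ 1 ∷ 3 ∷ 0 ∷ 4 ∷ [])) tt tt tt

interiorWindow : Window → (ℕ → Bool) → (ℕ → ℕ) → ℕ → Bool
interiorWindow F m g t = F (leftOf (m ∘ g) t) (m (g t)) (m (g (suc t)))

endWindow : Window → (ℕ → Bool) → (ℕ → ℕ) → ℕ → Bool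
endWindow F m g t = F (leftOf (m ∘ g) t) (m (g t)) false

module _ {n : ℕ} (g : ℕ → ℕ) (F : Window) (m : ℕ → Bool) where

  private
    leftOf-select : ∀ t → t < n → leftOf (select n g m) t ≡ leftOf (m ∘ g) t
    leftOf-select zero    _   = refl
    leftOf-select (suc t) t<n = select-< g m (≤-trans (n≤1+n (suc t)) t<n)

  windowAt-interior : ∀ t → suc t < n → windowAt F (select n g m) t ≡ interiorWindow F m g t
  windowAt-interior t t+1<n = window-cong F (leftOf-select t t<n) (select-< g m t<n) (select-< g m t+1<n)
    where
      t<n : t < n
      t<n = ≤-trans (n≤1+n (suc t)) t+1<n

  windowAt-end : ∀ t → suc t ≡ n → windowAt F (select n g m) t ≡ endWindow F m g t
  windowAt-end t refl = window-cong F (leftOf-select t ≤-refl) (select-< g m ≤-refl) (select-n n g m)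

  holdsOnPath-windows : (∀ t → suc t < n → T (interiorWindow F m g t)) → (∀ t → suc t ≡ n → T (endWindow F m g t)) →
                        T (holdsOnPath n F (select n g m))
  holdsOnPath-windows interior end = allBelow⁺ n _ λ t t<n → window t t<n
    where
      window : ∀ t → t < n → T (windowAt F (select n g m) t)
      window t t<n with suc t ≟ n
      ... | yes t+1≡n = subst T (sym (windowAt-end t t+1≡n)) (end t t+1≡n)
      ... | no  t+1≢n = subst T (sym (windowAt-interior t (≤∧≢⇒< t<n t+1≢n))) (interior t (≤∧≢⇒< t<n t+1≢n))

labelWindows : ℕ → (ℕ → ℕ) → (Window → (ℕ → Bool) → (ℕ → ℕ) → ℕ → Bool) → (ℕ → ℕ) → ℕ → Bool
labelWindows k partner W g t = allBelow k λ j →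
  W dominatedW (inPair j (partner j)) g t ∧ (W atMostOneW (inPair j (partner j)) g t ∧ W atMostOneW (isLabel j) g t)

module _ {n k s : ℕ} (s<n : s < n) (g partner : ℕ → ℕ) (g<k : ∀ t → g t < k) (used : T (labelsUsed n k g s))
         (partnerValid : T (allBelow k λ j → not (j ≡ᵇ partner j) ∧ (partner j <ᵇ k)))
         (undominated : T (allBelow k λ j → anyBelow s λ y → not (interiorWindow dominatedW (isLabel j) g y)))
         (interior : ∀ t → suc t < n → T (labelWindows k partner interiorWindow g t))
         (end : ∀ t → suc t ≡ n → T (labelWindows k partner endWindow g t)) where

  private
    module Label {j} (j<k : j < k) where
      j≢partner : T (not (j ≡ᵇ partner j))
      j≢partner = proj₁ (∧-elim (not (j ≡ᵇ partner j)) (allBelow⁻ k _ partnerValid j j<k))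

      partner<k : partner j < k
      partner<k = <ᵇ⇒< (partner j) k (proj₂ (∧-elim (not (j ≡ᵇ partner j)) (allBelow⁻ k _ partnerValid j j<k)))

      windows : ∀ W t → T (labelWindows k partner W g t) →
                T (W dominatedW (inPair j (partner j)) g t) × T (W atMostOneW (inPair j (partner j)) g t) ×
                T (W atMostOneW (isLabel j) g t)
      windows W t h with ∧-elim (W dominatedW (inPair j (partner j)) g t) (allBelow⁻ k _ h j j<k)
      ... | d , amos with ∧-elim (W atMostOneW (inPair j (partner j)) g t) amos
      ...   | a , a₁ = d , a , a₁

      holds : ∀ F m → (∀ W t → T (labelWindows k partner W g t) → T (W F m g t)) → T (onPath n g F m)
      holds F m pick = holdsOnPath-windows g F m (λ t t+1<n → pick interiorWindow t (interior t t+1<n))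
                                              (λ t t+1≡n → pick endWindow t (end t t+1≡n))

      amo : T (onPath n g atMostOneW (isLabel j))
      amo = holds atMostOneW (isLabel j) λ W t h → proj₂ (proj₂ (windows W t h))

      ¬dom : ¬ T (onPath n g dominatedW (isLabel j))
      ¬dom dom with anyBelow⁻ s _ (allBelow⁻ k _ undominated j j<k)
      ... | y , y<s , ¬window = not-elim _ ¬window (subst T (windowAt-interior g dominatedW (isLabel j) y y+1<n)
                                    (allBelow⁻ n _ dom y (≤-trans (n≤1+n _) y+1<n)))
        where
          y+1<n : suc y < n
          y+1<n = ≤-trans (s≤s y<s) s<n

    coalitionWithPartner : ∀ {j} (j<k : j < k) → T (coalition (onPath n g) j (partner j))
    coalitionWithPartner {j} j<k = from (coalition⇔ (onPath n g) j (partner j))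
      ( holds dominatedW (inPair j (partner j)) (λ W t h → proj₁ (windows W t h))
      , holds atMostOneW (inPair j (partner j)) (λ W t h → proj₁ (proj₂ (windows W t h)))
      , amo , Label.amo partner<k , ¬dom , Label.¬dom partner<k )
      where open Label j<k

  windowChecked⇒partition : HasPRCPartition (P n) k
  windowChecked⇒partition = pairedLabelling⇒partition (λ t _ → g<k t) (labelsUsed⇒ n k g (<⇒≤ s<n) used)
    (allBelow⁺ k _ λ j j<k → anyBelow⁺ k _ (partner j) (Label.partner<k j<k)
                               (∧-intro (Label.j≢partner j<k) (coalitionWithPartner j<k)))

cycle : ℕ → ℕ
cycle 0 = 0
cycle 1 = 1
cycle 2 = 1
cycle 3 = 0
cycle (suc (suc (suc (suc x)))) = cycle x

evenLabelling : ℕ → ℕ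
evenLabelling (suc (suc (suc (suc (suc (suc (suc (suc (suc (suc t)))))))))) = cycle t
evenLabelling t = fromList (0 ∷ 1 ∷ 2 ∷ 0 ∷ 3 ∷ 1 ∷ 0 ∷ 4 ∷ 1 ∷ 5 ∷ []) t

oddLabelling : ℕ → ℕ
oddLabelling (suc (suc (suc (suc (suc (suc (suc (suc (suc (suc (suc (suc (suc t))))))))))))) = cycle t
oddLabelling t = fromList (0 ∷ 1 ∷ 2 ∷ 0 ∷ 3 ∷ 1 ∷ 0 ∷ 4 ∷ 1 ∷ 5 ∷ 4 ∷ 1 ∷ 5 ∷ []) t

partnerLabel : ℕ → ℕ
partnerLabel 0 = 4
partnerLabel 1 = 2
partnerLabel 2 = 1
partnerLabel 3 = 1
partnerLabel _ = 0

fromThreshold : ∀ (f : ℕ → Bool) s → T (allBelow s f) → (∀ x → T (f (s + x))) → ∀ t → T (f t)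
fromThreshold f s below above t with t <? s
... | yes t<s = allBelow⁻ s f below t t<s
... | no  t≮s with m≤n⇒∃[o]m+o≡n (≮⇒≥ t≮s)
...   | x , refl = above x

parity : ∀ m → ∃ λ w → m ≡ w * 2 ⊎ m ≡ suc (w * 2)
parity zero = 0 , inj₁ refl
parity (suc m) with parity m
... | w , inj₁ refl = w , inj₂ refl
... | w , inj₂ refl = suc w , inj₁ refl

private
  cycle<6 : ∀ x → T (cycle x <ᵇ 6)
  cycle<6 0 = tt
  cycle<6 1 = tt
  cycle<6 2 = tt
  cycle<6 3 = tt
  cycle<6 (suc (suc (suc (suc x)))) = cycle<6 x

  evenCycleWindows : ∀ x → T (labelWindows 6 partnerLabel interiorWindow evenLabelling (11 + x))
  evenCycleWindows 0 = tt
  evenCycleWindows 1 = tt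
  evenCycleWindows 2 = tt
  evenCycleWindows 3 = tt
  evenCycleWindows (suc (suc (suc (suc x)))) = evenCycleWindows x

  oddCycleWindows : ∀ x → T (labelWindows 6 partnerLabel interiorWindow oddLabelling (14 + x))
  oddCycleWindows 0 = tt
  oddCycleWindows 1 = tt
  oddCycleWindows 2 = tt
  oddCycleWindows 3 = tt
  oddCycleWindows (suc (suc (suc (suc x)))) = oddCycleWindows x

  evenEndWindows : ∀ w → T (labelWindows 6 partnerLabel endWindow evenLabelling (13 + w * 2))
  evenEndWindows 0 = tt
  evenEndWindows 1 = tt
  evenEndWindows (suc (suc w)) = evenEndWindows w

  oddEndWindows : ∀ w → T (labelWindows 6 partnerLabel endWindow oddLabelling (14 + w * 2))
  oddEndWindows 0 = tt
  oddEndWindows 1 = tt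
  oddEndWindows (suc (suc w)) = oddEndWindows w

  evenLabelling<6 : ∀ t → evenLabelling t < 6
  evenLabelling<6 t = <ᵇ⇒< _ 6 (fromThreshold (λ t → evenLabelling t <ᵇ 6) 10 tt cycle<6 t)

  oddLabelling<6 : ∀ t → oddLabelling t < 6
  oddLabelling<6 t = <ᵇ⇒< _ 6 (fromThreshold (λ t → oddLabelling t <ᵇ 6) 13 tt cycle<6 t)

  evenInteriorWindows : ∀ t → T (labelWindows 6 partnerLabel interiorWindow evenLabelling t)
  evenInteriorWindows = fromThreshold (labelWindows 6 partnerLabel interiorWindow evenLabelling) 11 tt evenCycleWindows

  oddInteriorWindows : ∀ t → T (labelWindows 6 partnerLabel interiorWindow oddLabelling t)
  oddInteriorWindows = fromThreshold (labelWindows 6 partnerLabel interiorWindow oddLabelling) 14 tt oddCycleWindows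

  onlyAt : ∀ {f : ℕ → Bool} {t₀ n} → suc t₀ ≡ n → T (f t₀) → ∀ t → suc t ≡ n → T (f t)
  onlyAt refl ft₀ t refl = ft₀

prcPartition-large : ∀ m → HasPRCPartition (P (14 + m)) 6
prcPartition-large m with parity m
... | w , inj₁ refl = windowChecked⇒partition {s = 13} (m≤m+n 14 (w * 2)) evenLabelling partnerLabel evenLabelling<6
                        tt tt tt (λ t _ → evenInteriorWindows t) (onlyAt refl (evenEndWindows w))
... | w , inj₂ refl = windowChecked⇒partition {s = 13} (m≤m+n 14 (suc (w * 2))) oddLabelling partnerLabel oddLabelling<6
                        tt tt tt (λ t _ → oddInteriorWindows t) (onlyAt refl (oddEndWindows w))

classes≤vertices : ∀ {n k} → HasPRCPartition (P n) k → k ≤ n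
classes≤vertices {n} {k} (π , _) = injective⇒≤ {f = representative} λ {i} {i′} eq →
  trans (sym (proj₂ (surj i))) (trans (cong cls eq) (proj₂ (surj i′)))
  where
    open Partition π
    representative : Fin k → Fin n
    representative i = proj₁ (surj i)

prc≤6 : ∀ {n k} → 4 ≤ n → HasPRCPartition (P n) k → k ≤ 6
prc≤6 {suc (suc m)} {k} 4≤n (π , prc) = pairedLabelling≤6 {m} {k} {lab} (paired-holds 4≤n)
  where open FromPartition π prc
prc≤6 {0}     ()
prc≤6 {1}     (s≤s ())

refutedAbove : ℕ → ℕ → Bool
refutedAbove n k = (k ≤ᵇ prcPath n) ∨ not (search (prefixPaired k) (prcWord k) k n [])

searchRefutes : ℕ → Bool
searchRefutes n = allBelow 7 (refutedAbove n)

allBelow-≡⁻ : ∀ k f → allBelow k f ≡ true → ∀ j → j < k → T (f j)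
allBelow-≡⁻ k f all≡true = allBelow⁻ k f (subst T (sym all≡true) tt)

-- Stated as equations, which refl settles by normalisation; a goal T (…) of the same term
-- makes the type checker reduce it far more slowly.
searchRefutes-table : allBelow 14 searchRefutes ≡ true
searchRefutes-table = refl

P3-searchFails : allBelow 4 (λ k → not (search noPruning (prcWord k) k 3 [])) ≡ true
P3-searchFails = refl

noPRCPartition-P3 : ∀ k → ¬ HasPRCPartition (P 3) k
noPRCPartition-P3 k H@(π , prc) =
  not-elim _ (allBelow-≡⁻ 4 (λ k → not (search noPruning (prcWord k) k 3 [])) P3-searchFails k (s≤s (classes≤vertices H)))
             (search-succeeds noPruning (λ _ _ _ _ → tt))
  where open FromPartition π prc

refuted⇒≤ : ∀ {k b} s → T ((k ≤ᵇ b) ∨ not s) → T s → k ≤ b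
refuted⇒≤ {k} {b} s bound-or-refuted succeeds with ∨-elim (k ≤ᵇ b) bound-or-refuted
... | inj₁ k≤b     = ≤ᵇ⇒≤ k b k≤b
... | inj₂ refuted = contradiction succeeds (not-elim s refuted)

prc≤prcPath-4to13 : ∀ n k → 4 ≤ n → n < 14 → HasPRCPartition (P n) k → k ≤ prcPath n
prc≤prcPath-4to13 (suc n) k 4≤n n<14 H@(π , prc) =
  refuted⇒≤ (search (prefixPaired k) (prcWord k) k (suc n) [])
    (allBelow⁻ 7 (refutedAbove (suc n)) (allBelow-≡⁻ 14 searchRefutes searchRefutes-table (suc n) n<14) k (s≤s (prc≤6 4≤n H)))
    (pruned-search-succeeds 4≤n)
  where open FromPartition π prc

prc≤prcPath-large : ∀ m k → HasPRCPartition (P (14 + m)) k → k ≤ prcPath (14 + m)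
prc≤prcPath-large m k H = prc≤6 (s≤s (s≤s (s≤s (s≤s z≤n)))) H

prc≤prcPath : ∀ n → 1 ≤ n → n ≢ 3 → ∀ k → HasPRCPartition (P n) k → k ≤ prcPath n
prc≤prcPath 1 _ _   k H = classes≤vertices H
prc≤prcPath 2 _ _   k H = classes≤vertices H
prc≤prcPath 3 _ n≢3 k H = contradiction refl n≢3
prc≤prcPath n@(suc (suc (suc (suc _)))) _ _ k H with n <? 14
... | yes n<14 = prc≤prcPath-4to13 n k (s≤s (s≤s (s≤s (s≤s z≤n)))) n<14 H
... | no  n≮14 = let m , 14+m≡n = m≤n⇒∃[o]m+o≡n (≮⇒≥ n≮14) in
  subst (λ n → HasPRCPartition (P n) k → k ≤ prcPath n) 14+m≡n (prc≤prcPath-large m k) H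

discretePartition : ∀ G → (∀ u v → u ≢ v → Adj G u v) → HasPRCPartition G (order G)
discretePartition G complete =
  record { cls = λ v → v ; surj = λ i → i , refl } ,
  λ i → inj₁ ((i , refl , λ _ w≡i → w≡i) , λ v v≢i → i , refl , complete v i v≢i)

P1-complete : ∀ (u v : Fin 1) → u ≢ v → Adj (P 1) u v
P1-complete fzero fzero u≢v = contradiction refl u≢v

P2-complete : ∀ (u v : Fin 2) → u ≢ v → Adj (P 2) u v
P2-complete fzero        fzero        u≢v = contradiction refl u≢v
P2-complete fzero        (fsuc fzero) _   = inj₁ refl
P2-complete (fsuc fzero) fzero        _   = inj₂ refl
P2-complete (fsuc fzero) (fsuc fzero) u≢v = contradiction refl u≢v

prcPartition : ∀ n → 1 ≤ n → n ≢ 3 → HasPRCPartition (P n) (prcPath n)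
prcPartition 1  _ _   = discretePartition (P 1) P1-complete
prcPartition 2  _ _   = discretePartition (P 2) P2-complete
prcPartition 3  _ n≢3 = contradiction refl n≢3
prcPartition 4  _ _   = prcPartition-P4
prcPartition 5  _ _   = prcPartition-P5
prcPartition 6  _ _   = prcPartition-P6
prcPartition 7  _ _   = prcPartition-P7
prcPartition 8  _ _   = prcPartition-P8
prcPartition 9  _ _   = prcPartition-P9
prcPartition 10 _ _   = prcPartition-P10
prcPartition 11 _ _   = prcPartition-P11
prcPartition 12 _ _   = prcPartition-P12
prcPartition 13 _ _   = prcPartition-P13
prcPartition (suc (suc (suc (suc (suc (suc (suc (suc (suc (suc (suc (suc (suc (suc m)))))))))))))) _ _ = prcPartition-large m

theorem3p3 : ∀ (n : ℕ) → 1 ≤ n → PRC≡ (P n) (prcPath n)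
theorem3p3 n 1≤n with n ≟ 3
... | yes refl = inj₂ (refl , noPRCPartition-P3)
... | no  n≢3  = inj₁ (prcPartition n 1≤n n≢3 , prc≤prcPath n 1≤n n≢3)
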